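{- Let $G$ be a finite simple graph on $d$ vertices. For each acyclic orientation $\rho$ of $G$ fix a natural labeling of $\Pi_\rho$. Then, as formal power series in $q$, \[ P_G(q) \;=\; \frac{ q^d \sum_{(\rho,\sigma)} q^{ \operatorname{maj} \sigma^{\mathrm{op}} } }{ (1-q) (1-q^2) \cdots (1-q^d) } \;=\; \frac{ q^{ \binom{ d+1 } 2 } \sum_{(\rho,\sigma)} q^{ - \operatorname{maj} \sigma } }{ (1-q) (1-q^2) \cdots (1-q^d) }, \] where each sum ranges over all pairs of an acyclic orientation $\rho$ of $G$ and a linear extension $\sigma\in\mathcal{L}(\Pi_\rho)$.
   Context: For a graph $G=(V,E)$, a $G$-partition of $n\in\mathbb{Z}_{>0}$ is a tuple $m\in\mathbb{Z}_{>0}^V$ with $\sum_{v\in V}m_v=n$ and $m_v\ne m_w$ whenever $vw\in E$; $p_G(n)$ is the number of $G$-partitions of $n$ and $P_G(q):=\sum_{n>0}p_G(n)q^n$. $\Pi_\rho$ is the poset on $V$ with $u\preceq w$ iff there is a directed path (possibly of length 0) from $u$ to $w$ in $\rho$. A natural labeling of a $d$-element poset $\Pi$ is a bijection $\omega:\Pi\to[d]$ with $\omega(x)<\omega(y)$ whenever $x\prec y$; a linear extension $y_1,\dots,y_d$ (a listing with $y_i\prec y_j\Rightarrow i<j$) is identified with the permutation $\sigma=(\omega(y_1),\dots,\omega(y_d))$ of $[d]$, and $\mathcal{L}(\Pi)$ is the set of these. For a permutation $\sigma$ of $[d]$: $\operatorname{maj}\sigma=\sum_{j\in[d-1]:\,\sigma(j+1)<\sigma(j)}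 j$ and $\sigma^{\mathrm{op}}(j):=\sigma(d+1-j)$. -}

module Defs where

open import Data.Bool using (Bool; true; false; _∧_; _∨_; not; if_then_else_; _xor_)
open import Data.Nat using (ℕ; zero; suc; _+_; _*_; _∸_; _≡ᵇ_; _<ᵇ_; _%_)
open import Data.Nat.Combinatorics using (_C_)
open import Data.Fin using (Fin; toℕ; opposite; _≟_)
open import Data.List using (List; []; _∷_; map; length; filter; concatMap; allFin; upTo)
open import Data.Nat.ListAction using (sum)
open import Data.Bool.ListAction using (all; any)
open import Data.Bool using (T?)
open import Data.Vec.Functional as VF using ()
open import Data.Product using (_×_; _,_; proj₁; proj₂)
open import Relation.Nullary.Decidable using (⌊_⌋)
open import Function using (_∘_)

-- all functions Fin d → A whose values are taken from the list xs
-- (each function listed once if xs has no duplicates)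
allFuns : {A : Set} → List A → (d : ℕ) → List (Fin d → A)
allFuns xs zero    = (λ ()) ∷ []
allFuns xs (suc d) = concatMap (λ x → map (λ f → x VF.∷ f) (allFuns xs d)) xs

bools : List Bool
bools = true ∷ false ∷ []

∀ᵇ : {d : ℕ} → (Fin d → Bool) → Bool
∀ᵇ {d} P = all P (allFin d)

∃ᵇ : {d : ℕ} → (Fin d → Bool) → Bool
∃ᵇ {d} P = any P (allFin d)

_==_ : {d : ℕ} → Fin d → Fin d → Bool
i == j = ⌊ i ≟ j ⌋

_⇒ᵇ_ : Bool → Bool → Bool
a ⇒ᵇ b = not a ∨ b

-- Graphs on the vertex set Fin d are given by a Boolean adjacency
-- relation adj (assumed symmetric and irreflexive in the theorem).

Adj : ℕ → Set
Adj d = Fin d → Fin d → Bool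

-- G-partitions.  A tuple m ∈ ℤ_{>0}^V with Σ m = n has all parts in
-- {1,…,n}; we encode m_v = 1 + toℕ (f v) with f : Fin d → Fin n.
partOf : {d n : ℕ} → (Fin d → Fin n) → Fin d → ℕ
partOf f v = suc (toℕ (f v))

isGPartition : {d : ℕ} → Adj d → (n : ℕ) → (Fin d → Fin n) → Bool
isGPartition {d} adj n f =
  (sum (map (partOf f) (allFin d)) ≡ᵇ n)
  ∧ ∀ᵇ (λ v → ∀ᵇ (λ w → adj v w ⇒ᵇ not (partOf f v ≡ᵇ partOf f w)))

pG : {d : ℕ} → Adj d → ℕ → ℕ
pG {d} adj n = length (filter (λ f → T? (isGPartition adj n f)) (allFuns (allFin n) d))

-- Formal power series in q with natural-number coefficients,
-- represented by their coefficient sequences.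

Series : Set
Series = ℕ → ℕ

PG : {d : ℕ} → Adj d → Series
PG adj zero    = 0
PG adj (suc n) = pG adj (suc n)

_⊛_ : Series → Series → Series
(a ⊛ b) n = sum (map (λ k → a k * b (n ∸ k)) (upTo (suc n)))

oneS : Series
oneS zero    = 1
oneS (suc n) = 0

-- 1 / (1 - q^(i+1)) = Σ_k q^((i+1) k)
inv1-q^suc : ℕ → Series
inv1-q^suc i n = if n % suc i ≡ᵇ 0 then 1 else 0

invDen : ℕ → Series
invDen zero    = oneS
invDen (suc i) = invDen i ⊛ inv1-q^suc i

fromExponents : List ℕ → Series
fromExponents es n = length (filter (λ e → T? (e ≡ᵇ n)) es)

-- An orientation candidate: O u w = true means the arc u → w.
Orient : ℕ → Set
Orient d = Fin d → Fin d → Bool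

allOrientCandidates : (d : ℕ) → List (Orient d)
allOrientCandidates d = allFuns (allFuns bools d) d

reachWithin : {d : ℕ} → Orient d → ℕ → Fin d → Fin d → Bool
reachWithin O zero    u w = u == w
reachWithin O (suc k) u w = reachWithin O k u w ∨ ∃ᵇ (λ v → reachWithin O k u v ∧ O v w)

-- u ⪯ w in Π_ρ : a directed path from u to w (on d vertices a path of
-- length ≤ d always suffices)
reach : {d : ℕ} → Orient d → Fin d → Fin d → Bool
reach {d} O = reachWithin O d

isOrientation : {d : ℕ} → Adj d → Orient d → Bool
isOrientation adj O =
  ∀ᵇ (λ u → ∀ᵇ (λ w → (O u w ⇒ᵇ adj u w) ∧ (adj u w ⇒ᵇ (O u w xor O w u))))

isAcyclic : {d : ℕ} → Orient d → Bool
isAcyclic O = ∀ᵇ (λ u → ∀ᵇ (λ v → O u v ⇒ᵇ not (reach O v u)))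

isAcyclicOrientation : {d : ℕ} → Adj d → Orient d → Bool
isAcyclicOrientation adj O = isOrientation adj O ∧ isAcyclic O

isListing : {d : ℕ} → (Fin d → Fin d) → Bool
isListing y = ∀ᵇ (λ i → ∀ᵇ (λ j → (y i == y j) ⇒ᵇ (i == j)))
            ∧ ∀ᵇ (λ v → ∃ᵇ (λ i → y i == v))

isLinExt : {d : ℕ} → Orient d → (Fin d → Fin d) → Bool
isLinExt O y = isListing y ∧
  ∀ᵇ (λ i → ∀ᵇ (λ j → (reach O (y i) (y j) ∧ not (y i == y j)) ⇒ᵇ (toℕ i <ᵇ toℕ j)))

majFrom : ℕ → List ℕ → ℕ
majFrom j []           = 0
majFrom j (a ∷ [])     = 0
majFrom j (a ∷ b ∷ cs) = (if b <ᵇ a then j else 0) + majFrom (suc j) (b ∷ cs)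

maj : {d : ℕ} → (Fin d → Fin d) → ℕ
maj {d} σ = majFrom 1 (map (toℕ ∘ σ) (allFin d))

op : {d : ℕ} → (Fin d → Fin d) → (Fin d → Fin d)
op σ = σ ∘ opposite

-- The pairs (ρ, σ): ρ an acyclic orientation of G, y a linear extension
-- of Π_ρ; σ = ω ρ ∘ y is the associated permutation.

pairs : {d : ℕ} → Adj d → List (Orient d × (Fin d → Fin d))
pairs {d} adj =
  concatMap (λ O → map (λ y → O , y) (filter (λ y → T? (isLinExt O y)) (allFuns (allFin d) d)))
            (filter (λ O → T? (isAcyclicOrientation adj O)) (allOrientCandidates d))

numer₁ : {d : ℕ} → Adj d → (Orient d → Fin d → Fin d) → Series
numer₁ {d} adj ω =
  fromExponents (map (λ p → d + maj (op (ω (proj₁ p) ∘ proj₂ p))) (pairs adj))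

numer₂ : {d : ℕ} → Adj d → (Orient d → Fin d → Fin d) → Series
numer₂ {d} adj ω =
  fromExponents (map (λ p → (suc d C 2) ∸ maj (ω (proj₁ p) ∘ proj₂ p)) (pairs adj))

-- Fix a strict total order ≺ on part sizes: < for the first formula, > for the second.  A G-partition m
-- determines a unique acyclic orientation ρ (each edge points to its ≺-larger end) and a unique linear
-- extension y of Π_ρ (sort by part, ties by decreasing label) such that m is ≺-weakly increasing along y
-- and strictly increasing at every ascent of σ = ω ∘ y; conversely, an m compatible in this sense with
-- some (ρ, y) is proper.  So p_G(n) counts pairs (ρ, y) with a compatible m of size n.  For fixed (ρ, y),
-- subtracting the forced increments turns compatible m into partitions with at most d parts, which gives
-- q^e / ((1-q)⋯(1-q^d)) with e = d + Σ_{ascents i of σ} (d - i) = d + maj σ^op when ≺ is <.  When ≺ is >,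
-- y is read backwards, and e = C(d+1,2) - maj σ.

module Submission where

module GPartitions where

  open import Data.Bool using (Bool; true; false; _∧_; _∨_; not; if_then_else_; _xor_; T; T?)
  open import Data.Bool.Properties using (∧-zeroʳ)
  open import Data.Bool.ListAction using (all; any)
  open import Data.Empty using (⊥; ⊥-elim)
  open import Data.Fin using (Fin; toℕ; fromℕ; fromℕ<; inject₁; opposite; punchOut)
    renaming (zero to fzero; suc to fsuc)
  open import Data.Fin.Properties
    using (toℕ-fromℕ<; toℕ<n; toℕ-injective; any?; pigeonhole; punchOut-injective;
           opposite-prop; opposite-involutive)
    renaming (_≟_ to _≟ᶠ_; suc-injective to fsuc-injective)
  open import Data.List
    using (List; []; _∷_; map; length; filter; concatMap; allFin; upTo; tabulate; _++_; concat;
           applyUpTo; reverse; _∷ʳ_)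
  open import Data.List.Properties
    using (map-tabulate; length-map; length-tabulate; unfold-reverse; reverse-++; reverse-involutive;
           ++-assoc; length-reverse)
  open import Data.Nat
    using (ℕ; zero; suc; _+_; _*_; _∸_; _≤_; _<_; _≰_; z≤n; s≤s; _≡ᵇ_; _<ᵇ_; _≤ᵇ_; _≤?_)
  open import Data.Nat.Properties
  open import Data.Nat.Combinatorics using (_C_; nC1≡n; nCk+nC[k+1]≡[n+1]C[k+1])
  open import Data.Nat.DivMod using (m<n⇒m%n≡m; [m+n]%n≡m%n)
  open import Data.Nat.ListAction using (sum)
  open import Data.Nat.Solver using (module +-*-Solver)
  open import Data.Product using (Σ; _×_; _,_; proj₁; proj₂)
  open import Data.Sum using (_⊎_; inj₁; inj₂)
  open import Data.Unit using (⊤; tt)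
  open import Data.Vec.Functional as VF using ()
  open import Function using (_∘_; id; flip)
  open import Function.Definitions using (Bijective)
  open import Relation.Binary.Definitions using (Tri; tri<; tri≈; tri>)
  open import Relation.Binary.Structures using (IsStrictTotalOrder)
  import Relation.Binary.Construct.Flip.EqAndOrd as Flip
  open import Relation.Binary.PropositionalEquality
  open import Relation.Nullary using (yes; no; ¬_)
  open import Relation.Nullary.Decidable using (⌊_⌋)
  open import Defs

  ∧-elimˡ : {a b : Bool} → a ∧ b ≡ true → a ≡ true
  ∧-elimˡ {true} _ = refl

  ∧-elimʳ : {a b : Bool} → a ∧ b ≡ true → b ≡ true
  ∧-elimʳ {true} e = e

  ∧-intro : {a b : Bool} → a ≡ true → b ≡ true → a ∧ b ≡ true
  ∧-intro refl refl = refl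

  ∨-elim : {a b : Bool} → a ∨ b ≡ true → a ≡ true ⊎ b ≡ true
  ∨-elim {true} _ = inj₁ refl
  ∨-elim {false} e = inj₂ e

  ∨-introˡ : {a b : Bool} → a ≡ true → a ∨ b ≡ true
  ∨-introˡ refl = refl

  ∨-introʳ : {a b : Bool} → b ≡ true → a ∨ b ≡ true
  ∨-introʳ {true} _ = refl
  ∨-introʳ {false} e = e

  ⇒ᵇ-elim : {a b : Bool} → (a ⇒ᵇ b) ≡ true → a ≡ true → b ≡ true
  ⇒ᵇ-elim {true} e refl = e

  ⇒ᵇ-intro : {a b : Bool} → (a ≡ true → b ≡ true) → (a ⇒ᵇ b) ≡ true
  ⇒ᵇ-intro {true} f = f refl
  ⇒ᵇ-intro {false} _ = refl

  not-elim : {a : Bool} → not a ≡ true → a ≡ false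
  not-elim {false} _ = refl

  not-intro : {a : Bool} → a ≡ false → not a ≡ true
  not-intro refl = refl

  true≢false : {a : Bool} → a ≡ true → a ≡ false → ⊥
  true≢false refl ()

  ¬true⇒false : {a : Bool} → ¬ a ≡ true → a ≡ false
  ¬true⇒false {true} n = ⊥-elim (n refl)
  ¬true⇒false {false} _ = refl

  xor-elim : {a b : Bool} → (a xor b) ≡ true → (a ≡ true × b ≡ false) ⊎ (a ≡ false × b ≡ true)
  xor-elim {true} {false} _ = inj₁ (refl , refl)
  xor-elim {false} {true} _ = inj₂ (refl , refl)

  xor-introˡ : {a b : Bool} → a ≡ true → b ≡ false → (a xor b) ≡ true
  xor-introˡ refl refl = refl

  xor-introʳ : {a b : Bool} → a ≡ false → b ≡ true → (a xor b) ≡ true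
  xor-introʳ refl refl = refl

  true⇔true⇒≡ : {a b : Bool} → (a ≡ true → b ≡ true) → (b ≡ true → a ≡ true) → a ≡ b
  true⇔true⇒≡ {true} {true} _ _ = refl
  true⇔true⇒≡ {true} {false} f _ = sym (f refl)
  true⇔true⇒≡ {false} {true} _ g = g refl
  true⇔true⇒≡ {false} {false} _ _ = refl

  ==⇒≡ : {d : ℕ} {i j : Fin d} → (i == j) ≡ true → i ≡ j
  ==⇒≡ {i = i} {j} e with i ≟ᶠ j
  ... | yes p = p

  ≡⇒== : {d : ℕ} {i j : Fin d} → i ≡ j → (i == j) ≡ true
  ≡⇒== {i = i} {j} p with i ≟ᶠ j
  ... | yes _ = refl
  ... | no np = ⊥-elim (np p)

  ≢⇒==-false : {d : ℕ} {i j : Fin d} → ¬ i ≡ j → (i == j) ≡ false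
  ≢⇒==-false {i = i} {j} p with i ≟ᶠ j
  ... | yes q = ⊥-elim (p q)
  ... | no _ = refl

  ≡ᵇ-true⇒≡ : {m n : ℕ} → (m ≡ᵇ n) ≡ true → m ≡ n
  ≡ᵇ-true⇒≡ {m} {n} e = ≡ᵇ⇒≡ m n (subst T (sym e) tt)

  ≡⇒≡ᵇ-true : {m n : ℕ} → m ≡ n → (m ≡ᵇ n) ≡ true
  ≡⇒≡ᵇ-true {m} {n} p with m ≡ᵇ n | ≡⇒≡ᵇ m n p
  ... | true | _ = refl

  <ᵇ-true⇒< : {m n : ℕ} → (m <ᵇ n) ≡ true → m < n
  <ᵇ-true⇒< {m} {n} e = <ᵇ⇒< m n (subst T (sym e) tt)

  <⇒<ᵇ-true : {m n : ℕ} → m < n → (m <ᵇ n) ≡ true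
  <⇒<ᵇ-true {m} {n} p with m <ᵇ n | <⇒<ᵇ p
  ... | true | _ = refl

  ≤ᵇ-true⇒≤ : {m n : ℕ} → (m ≤ᵇ n) ≡ true → m ≤ n
  ≤ᵇ-true⇒≤ {m} {n} e = ≤ᵇ⇒≤ m n (subst T (sym e) tt)

  ≤⇒≤ᵇ-true : {m n : ℕ} → m ≤ n → (m ≤ᵇ n) ≡ true
  ≤⇒≤ᵇ-true {m} {n} p with m ≤ᵇ n | ≤⇒≤ᵇ p
  ... | true | _ = refl

  ≰⇒≤ᵇ-false : {m n : ℕ} → m ≰ n → (m ≤ᵇ n) ≡ false
  ≰⇒≤ᵇ-false m≰n = ¬true⇒false (λ e → m≰n (≤ᵇ-true⇒≤ e))

  all-tabulate-elim : {A : Set} (P : A → Bool) {d : ℕ} (g : Fin d → A) →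
    all P (tabulate g) ≡ true → ∀ i → P (g i) ≡ true
  all-tabulate-elim P {suc d} g e fzero = ∧-elimˡ e
  all-tabulate-elim P {suc d} g e (fsuc i) = all-tabulate-elim P (g ∘ fsuc) (∧-elimʳ {P (g fzero)} e) i

  all-tabulate-intro : {A : Set} (P : A → Bool) {d : ℕ} (g : Fin d → A) →
    (∀ i → P (g i) ≡ true) → all P (tabulate g) ≡ true
  all-tabulate-intro P {zero} g f = refl
  all-tabulate-intro P {suc d} g f = ∧-intro (f fzero) (all-tabulate-intro P (g ∘ fsuc) (f ∘ fsuc))

  any-tabulate-elim : {A : Set} (P : A → Bool) {d : ℕ} (g : Fin d → A) →
    any P (tabulate g) ≡ true → Σ (Fin d) (λ i → P (g i) ≡ true)
  any-tabulate-elim P {suc d} g e with ∨-elim {P (g fzero)} e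
  ... | inj₁ p = fzero , p
  ... | inj₂ q with any-tabulate-elim P (g ∘ fsuc) q
  ...   | i , r = fsuc i , r

  any-tabulate-intro : {A : Set} (P : A → Bool) {d : ℕ} (g : Fin d → A) (i : Fin d) →
    P (g i) ≡ true → any P (tabulate g) ≡ true
  any-tabulate-intro P g fzero p = ∨-introˡ p
  any-tabulate-intro P g (fsuc i) p = ∨-introʳ {P (g fzero)} (any-tabulate-intro P (g ∘ fsuc) i p)

  ∀ᵇ-elim : {d : ℕ} {P : Fin d → Bool} → ∀ᵇ P ≡ true → ∀ i → P i ≡ true
  ∀ᵇ-elim {P = P} = all-tabulate-elim P id

  ∀ᵇ-intro : {d : ℕ} {P : Fin d → Bool} → (∀ i → P i ≡ true) → ∀ᵇ P ≡ true
  ∀ᵇ-intro {P = P} = all-tabulate-intro P id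

  ∃ᵇ-elim : {d : ℕ} {P : Fin d → Bool} → ∃ᵇ P ≡ true → Σ (Fin d) (λ i → P i ≡ true)
  ∃ᵇ-elim {P = P} = any-tabulate-elim P id

  ∃ᵇ-intro : {d : ℕ} {P : Fin d → Bool} (i : Fin d) → P i ≡ true → ∃ᵇ P ≡ true
  ∃ᵇ-intro {P = P} = any-tabulate-intro P id

  ⟦_⟧ : Bool → ℕ
  ⟦ true ⟧ = 1
  ⟦ false ⟧ = 0

  ⟦∧⟧ : (a b : Bool) → ⟦ a ∧ b ⟧ ≡ ⟦ a ⟧ * ⟦ b ⟧
  ⟦∧⟧ true b = sym (+-identityʳ ⟦ b ⟧)
  ⟦∧⟧ false b = refl

  ⟦⟧-mono : {a b : Bool} → (a ≡ true → b ≡ true) → ⟦ a ⟧ ≤ ⟦ b ⟧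
  ⟦⟧-mono {false} _ = z≤n
  ⟦⟧-mono {true} f rewrite f refl = ≤-refl

  ⟦⟧*-cong : (b : Bool) {x y : ℕ} → (b ≡ true → x ≡ y) → ⟦ b ⟧ * x ≡ ⟦ b ⟧ * y
  ⟦⟧*-cong true h = cong (_+ 0) (h refl)
  ⟦⟧*-cong false h = refl

  ⟦false⟧* : {b : Bool} (x : ℕ) → b ≡ false → ⟦ b ⟧ * x ≡ 0
  ⟦false⟧* x refl = refl

  ⟦true⟧* : {b : Bool} (x : ℕ) → b ≡ true → ⟦ b ⟧ * x ≡ x
  ⟦true⟧* x refl = +-identityʳ x

  ∑ : {A : Set} → (A → ℕ) → List A → ℕ
  ∑ f [] = 0
  ∑ f (x ∷ xs) = f x + ∑ f xs

  sum-map≡∑ : {A : Set} (f : A → ℕ) (xs : List A) → sum (map f xs) ≡ ∑ f xs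
  sum-map≡∑ f [] = refl
  sum-map≡∑ f (x ∷ xs) = cong (f x +_) (sum-map≡∑ f xs)

  ∑-cong : {A : Set} {f g : A → ℕ} → (∀ x → f x ≡ g x) → (xs : List A) → ∑ f xs ≡ ∑ g xs
  ∑-cong e [] = refl
  ∑-cong e (x ∷ xs) = cong₂ _+_ (e x) (∑-cong e xs)

  ∑-zero : {A : Set} (f : A → ℕ) → (∀ x → f x ≡ 0) → (xs : List A) → ∑ f xs ≡ 0
  ∑-zero f e [] = refl
  ∑-zero f e (x ∷ xs) rewrite e x = ∑-zero f e xs

  ∑-+ : {A : Set} (f g : A → ℕ) (xs : List A) → ∑ (λ x → f x + g x) xs ≡ ∑ f xs + ∑ g xs
  ∑-+ f g [] = refl
  ∑-+ f g (x ∷ xs) rewrite ∑-+ f g xs = +-+-interchange (f x) (g x) (∑ f xs) (∑ g xs)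
    where
    +-+-interchange : ∀ a b c e → a + b + (c + e) ≡ a + c + (b + e)
    +-+-interchange = solve 4 (λ a b c e → a :+ b :+ (c :+ e) := a :+ c :+ (b :+ e)) refl
      where open +-*-Solver

  ∑-*ˡ : {A : Set} (c : ℕ) (f : A → ℕ) (xs : List A) → ∑ (λ x → c * f x) xs ≡ c * ∑ f xs
  ∑-*ˡ c f [] = sym (*-zeroʳ c)
  ∑-*ˡ c f (x ∷ xs) rewrite ∑-*ˡ c f xs = sym (*-distribˡ-+ c (f x) (∑ f xs))

  ∑-*ʳ : {A : Set} (c : ℕ) (f : A → ℕ) (xs : List A) → ∑ (λ x → f x * c) xs ≡ ∑ f xs * c
  ∑-*ʳ c f xs = trans (∑-cong (λ x → *-comm (f x) c) xs) (trans (∑-*ˡ c f xs) (*-comm c (∑ f xs)))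

  ∑-++ : {A : Set} (f : A → ℕ) (xs ys : List A) → ∑ f (xs ++ ys) ≡ ∑ f xs + ∑ f ys
  ∑-++ f [] ys = refl
  ∑-++ f (x ∷ xs) ys rewrite ∑-++ f xs ys = sym (+-assoc (f x) (∑ f xs) (∑ f ys))

  ∑-map : {A B : Set} (f : B → ℕ) (g : A → B) (xs : List A) → ∑ f (map g xs) ≡ ∑ (f ∘ g) xs
  ∑-map f g [] = refl
  ∑-map f g (x ∷ xs) = cong (f (g x) +_) (∑-map f g xs)

  ∑-concatMap : {A B : Set} (f : B → ℕ) (g : A → List B) (xs : List A) →
    ∑ f (concatMap g xs) ≡ ∑ (λ x → ∑ f (g x)) xs
  ∑-concatMap f g [] = refl
  ∑-concatMap f g (x ∷ xs) =
    trans (∑-++ f (g x) (concat (map g xs))) (cong (∑ f (g x) +_) (∑-concatMap f g xs))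

  ∑-comm : {A B : Set} (R : A → B → ℕ) (xs : List A) (ys : List B) →
    ∑ (λ a → ∑ (R a) ys) xs ≡ ∑ (λ b → ∑ (λ a → R a b) xs) ys
  ∑-comm R [] ys = sym (∑-zero _ (λ _ → refl) ys)
  ∑-comm R (x ∷ xs) ys =
    trans (cong (∑ (R x) ys +_) (∑-comm R xs ys)) (sym (∑-+ (R x) (λ b → ∑ (λ a → R a b) xs) ys))

  ∑-filter : {A : Set} (f : A → ℕ) (P : A → Bool) (xs : List A) →
    ∑ f (filter (λ x → T? (P x)) xs) ≡ ∑ (λ x → ⟦ P x ⟧ * f x) xs
  ∑-filter f P [] = refl
  ∑-filter f P (x ∷ xs) with P x
  ... | true = cong₂ _+_ (sym (+-identityʳ (f x))) (∑-filter f P xs)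
  ... | false = ∑-filter f P xs

  length-filter≡∑ : {A : Set} (P : A → Bool) (xs : List A) →
    length (filter (λ x → T? (P x)) xs) ≡ ∑ (λ x → ⟦ P x ⟧) xs
  length-filter≡∑ P [] = refl
  length-filter≡∑ P (x ∷ xs) with P x
  ... | true = cong suc (length-filter≡∑ P xs)
  ... | false = length-filter≡∑ P xs

  ∑-mono-≤ : {A : Set} {f g : A → ℕ} → (∀ x → f x ≤ g x) → (xs : List A) → ∑ f xs ≤ ∑ g xs
  ∑-mono-≤ le [] = z≤n
  ∑-mono-≤ le (x ∷ xs) = +-mono-≤ (le x) (∑-mono-≤ le xs)

  ∑-tabulate : {A : Set} (f : A → ℕ) {n : ℕ} (g : Fin n → A) → ∑ f (tabulate g) ≡ ∑ (f ∘ g) (allFin n)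
  ∑-tabulate f {zero} g = refl
  ∑-tabulate f {suc n} g =
    cong (f (g fzero) +_) (trans (∑-tabulate f (g ∘ fsuc)) (sym (∑-tabulate (f ∘ g) fsuc)))

  ∑-allFin-suc : (n : ℕ) (f : Fin (suc n) → ℕ) → ∑ f (allFin (suc n)) ≡ f fzero + ∑ (f ∘ fsuc) (allFin n)
  ∑-allFin-suc n f = cong (f fzero +_) (∑-tabulate f fsuc)

  ∑-allFin-mono-< : {d : ℕ} {f g : Fin d → ℕ} → (∀ x → f x ≤ g x) →
    (x₀ : Fin d) → f x₀ < g x₀ → ∑ f (allFin d) < ∑ g (allFin d)
  ∑-allFin-mono-< {suc d} {f} {g} le x₀ lt =
    subst₂ _<_ (sym (∑-allFin-suc d f)) (sym (∑-allFin-suc d g)) (head+tail x₀ lt)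
    where
    head+tail : (x₀ : Fin (suc d)) → f x₀ < g x₀ →
      f fzero + ∑ (f ∘ fsuc) (allFin d) < g fzero + ∑ (g ∘ fsuc) (allFin d)
    head+tail fzero lt = +-mono-<-≤ lt (∑-mono-≤ (le ∘ fsuc) (allFin d))
    head+tail (fsuc x₀) lt = +-mono-≤-< (le fzero) (∑-allFin-mono-< (le ∘ fsuc) x₀ lt)

  ∑-allFin-1 : (d : ℕ) → ∑ (λ (_ : Fin d) → 1) (allFin d) ≡ d
  ∑-allFin-1 zero = refl
  ∑-allFin-1 (suc d) = trans (∑-allFin-suc d (λ _ → 1)) (cong suc (∑-allFin-1 d))

  ∑-allFuns-suc : {A : Set} (xs : List A) (d : ℕ) (f : (Fin (suc d) → A) → ℕ) →
    ∑ f (allFuns xs (suc d)) ≡ ∑ (λ x → ∑ (λ g → f (x VF.∷ g)) (allFuns xs d)) xs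
  ∑-allFuns-suc xs d f =
    trans (∑-concatMap f _ xs) (∑-cong (λ x → ∑-map f (x VF.∷_) (allFuns xs d)) xs)

  ∑< : ℕ → (ℕ → ℕ) → ℕ
  ∑< zero f = 0
  ∑< (suc n) f = f 0 + ∑< n (f ∘ suc)

  ∑-applyUpTo : (f g : ℕ → ℕ) (n : ℕ) → ∑ f (applyUpTo g n) ≡ ∑< n (f ∘ g)
  ∑-applyUpTo f g zero = refl
  ∑-applyUpTo f g (suc n) = cong (f (g 0) +_) (∑-applyUpTo f (g ∘ suc) n)

  ∑-upTo : (f : ℕ → ℕ) (n : ℕ) → ∑ f (upTo n) ≡ ∑< n f
  ∑-upTo f = ∑-applyUpTo f id

  ∑-allFin-toℕ : (n : ℕ) (f : ℕ → ℕ) → ∑ (f ∘ toℕ) (allFin n) ≡ ∑< n f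
  ∑-allFin-toℕ zero f = refl
  ∑-allFin-toℕ (suc n) f = trans (∑-allFin-suc n (f ∘ toℕ)) (cong (f 0 +_) (∑-allFin-toℕ n (f ∘ suc)))

  ∑<-cong : {f g : ℕ → ℕ} (n : ℕ) → (∀ k → k < n → f k ≡ g k) → ∑< n f ≡ ∑< n g
  ∑<-cong zero e = refl
  ∑<-cong (suc n) e = cong₂ _+_ (e 0 (s≤s z≤n)) (∑<-cong n (λ k k<n → e (suc k) (s≤s k<n)))

  ∑<-zero : (n : ℕ) (f : ℕ → ℕ) → (∀ k → f k ≡ 0) → ∑< n f ≡ 0
  ∑<-zero zero f e = refl
  ∑<-zero (suc n) f e rewrite e 0 = ∑<-zero n (f ∘ suc) (e ∘ suc)

  ∑<-+ : (a b : ℕ) (f : ℕ → ℕ) → ∑< (a + b) f ≡ ∑< a f + ∑< b (λ k → f (a + k))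
  ∑<-+ zero b f = refl
  ∑<-+ (suc a) b f rewrite ∑<-+ a b (f ∘ suc) = sym (+-assoc (f 0) (∑< a (f ∘ suc)) _)

  ∑<-last : (M : ℕ) (f : ℕ → ℕ) → (∀ k → k < M → f k ≡ 0) → ∑< (suc M) f ≡ f M
  ∑<-last zero f _ = +-identityʳ (f 0)
  ∑<-last (suc M) f z =
    trans (cong (_+ ∑< (suc M) (f ∘ suc)) (z 0 (s≤s z≤n)))
          (∑<-last M (f ∘ suc) (λ k k<M → z (suc k) (s≤s k<M)))

  ∑<-indicator : (M e : ℕ) (φ : ℕ → ℕ) → ∑< M (λ k → ⟦ e ≡ᵇ k ⟧ * φ k) ≡ ⟦ e <ᵇ M ⟧ * φ e
  ∑<-indicator zero e φ = refl
  ∑<-indicator (suc M) zero φ = trans (cong (φ 0 + 0 +_) (∑<-zero M _ (λ _ → refl))) (+-identityʳ _)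
  ∑<-indicator (suc M) (suc e) φ = ∑<-indicator M e (φ ∘ suc)

  pointwise : {A B : Set} (E : A → B → Bool) {d : ℕ} → (Fin d → A) → (Fin d → B) → Bool
  pointwise E {zero} f g = true
  pointwise E {suc d} f g = E (f fzero) (g fzero) ∧ pointwise E (f ∘ fsuc) (g ∘ fsuc)

  pointwise-elim : {A B : Set} {E : A → B → Bool} {d : ℕ} {f : Fin d → A} {g : Fin d → B} →
    pointwise E f g ≡ true → ∀ i → E (f i) (g i) ≡ true
  pointwise-elim {d = suc d} e fzero = ∧-elimˡ e
  pointwise-elim {E = E} {suc d} {f} {g} e (fsuc i) =
    pointwise-elim {E = E} (∧-elimʳ {E (f fzero) (g fzero)} e) i

  pointwise-intro : {A B : Set} {E : A → B → Bool} {d : ℕ} {f : Fin d → A} {g : Fin d → B} →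
    (∀ i → E (f i) (g i) ≡ true) → pointwise E f g ≡ true
  pointwise-intro {d = zero} h = refl
  pointwise-intro {E = E} {suc d} h = ∧-intro (h fzero) (pointwise-intro {E = E} (h ∘ fsuc))

  ==-fsuc : {d : ℕ} (a b : Fin d) → (fsuc a == fsuc b) ≡ (a == b)
  ==-fsuc a b = true⇔true⇒≡ (λ e → ≡⇒== (fsuc-injective (==⇒≡ {i = fsuc a} {j = fsuc b} e)))
                            (λ e → ≡⇒== (cong fsuc (==⇒≡ e)))

  ∑-allFin-point : {d : ℕ} (u : Fin d) (h : Fin d → ℕ) → ∑ (λ v → ⟦ v == u ⟧ * h v) (allFin d) ≡ h u
  ∑-allFin-point {suc d} u h = trans (∑-allFin-suc d _) (split u h)
    where
    split : (u : Fin (suc d)) (h : Fin (suc d) → ℕ) →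
      ⟦ fzero == u ⟧ * h fzero + ∑ (λ v → ⟦ fsuc v == u ⟧ * h (fsuc v)) (allFin d) ≡ h u
    split fzero h =
      trans (cong₂ _+_ (+-identityʳ (h fzero))
                       (∑-zero _ (λ v → cong (λ b → ⟦ b ⟧ * h (fsuc v))
                           (≢⇒==-false {i = fsuc v} {j = fzero} (λ ()))) (allFin d)))
            (+-identityʳ _)
    split (fsuc u) h =
      trans (cong (_+ ∑ (λ v → ⟦ fsuc v == fsuc u ⟧ * h (fsuc v)) (allFin d))
                  (cong (λ b → ⟦ b ⟧ * h fzero) (≢⇒==-false {i = fzero} {j = fsuc u} (λ ()))))
            (trans (∑-cong (λ v → cong (λ b → ⟦ b ⟧ * h (fsuc v)) (==-fsuc v u)) (allFin d))
                   (∑-allFin-point u (h ∘ fsuc)))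

  ∑-allFin-indicator : {d : ℕ} (u : Fin d) → ∑ (λ v → ⟦ v == u ⟧) (allFin d) ≡ 1
  ∑-allFin-indicator {d} u =
    trans (∑-cong (λ v → sym (*-identityʳ _)) (allFin d)) (∑-allFin-point u (λ _ → 1))

  ∑-allFuns-pointwise : {A B : Set} (E : A → B → Bool) (xs : List A) →
    (∀ b → ∑ (λ a → ⟦ E a b ⟧) xs ≡ 1) →
    ∀ d (g : Fin d → B) → ∑ (λ f → ⟦ pointwise E f g ⟧) (allFuns xs d) ≡ 1
  ∑-allFuns-pointwise E xs u zero g = refl
  ∑-allFuns-pointwise E xs u (suc d) g = begin
      ∑ (λ f → ⟦ pointwise E f g ⟧) (allFuns xs (suc d))
    ≡⟨ ∑-allFuns-suc xs d _ ⟩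
      ∑ (λ x → ∑ (λ h → ⟦ E x (g fzero) ∧ pointwise E h (g ∘ fsuc) ⟧) (allFuns xs d)) xs
    ≡⟨ ∑-cong (λ x → trans (∑-cong (λ h → ⟦∧⟧ (E x (g fzero)) _) (allFuns xs d))
                           (∑-*ˡ ⟦ E x (g fzero) ⟧ _ (allFuns xs d))) xs ⟩
      ∑ (λ x → ⟦ E x (g fzero) ⟧ * ∑ (λ h → ⟦ pointwise E h (g ∘ fsuc) ⟧) (allFuns xs d)) xs
    ≡⟨ ∑-cong (λ x → trans (cong (⟦ E x (g fzero) ⟧ *_) (∑-allFuns-pointwise E xs u d (g ∘ fsuc)))
                           (*-identityʳ _)) xs ⟩
      ∑ (λ x → ⟦ E x (g fzero) ⟧) xs
    ≡⟨ u (g fzero) ⟩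
      1
    ∎
    where open ≡-Reasoning

  ∑-unique-point : {A : Set} (P : A → Bool) (φ : A → ℕ) (c : ℕ) (xs : List A) →
    (∀ a → P a ≡ true → φ a ≡ c) → ∑ (λ a → ⟦ P a ⟧) xs ≡ 1 → ∑ (λ a → ⟦ P a ⟧ * φ a) xs ≡ c
  ∑-unique-point P φ c xs const one =
    trans (∑-cong (λ a → ⟦⟧*-cong (P a) (const a)) xs)
          (trans (∑-*ʳ c (λ a → ⟦ P a ⟧) xs) (trans (cong (_* c) one) (+-identityʳ c)))

  sameFun : {d n : ℕ} → (Fin d → Fin n) → (Fin d → Fin n) → Bool
  sameFun = pointwise _==_

  sameFun⇒≗ : {d n : ℕ} {f g : Fin d → Fin n} → sameFun f g ≡ true → ∀ i → f i ≡ g i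
  sameFun⇒≗ e i = ==⇒≡ (pointwise-elim {E = _==_} e i)

  ≗⇒sameFun : {d n : ℕ} {f g : Fin d → Fin n} → (∀ i → f i ≡ g i) → sameFun f g ≡ true
  ≗⇒sameFun h = pointwise-intro {E = _==_} (λ i → ≡⇒== (h i))

  ∑-allFuns-indicator : (d n : ℕ) (g : Fin d → Fin n) →
    ∑ (λ f → ⟦ sameFun f g ⟧) (allFuns (allFin n) d) ≡ 1
  ∑-allFuns-indicator d n = ∑-allFuns-pointwise _==_ (allFin n) ∑-allFin-indicator d

  eqᵇ : Bool → Bool → Bool
  eqᵇ true b = b
  eqᵇ false b = not b

  eqᵇ⇒≡ : {a b : Bool} → eqᵇ a b ≡ true → a ≡ b
  eqᵇ⇒≡ {true} {true} _ = refl
  eqᵇ⇒≡ {false} {false} _ = refl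

  ≡⇒eqᵇ : {a b : Bool} → a ≡ b → eqᵇ a b ≡ true
  ≡⇒eqᵇ {true} refl = refl
  ≡⇒eqᵇ {false} refl = refl

  ∑-bools-indicator : ∀ b → ∑ (λ a → ⟦ eqᵇ a b ⟧) bools ≡ 1
  ∑-bools-indicator true = refl
  ∑-bools-indicator false = refl

  sameOrient : {d : ℕ} → Orient d → Orient d → Bool
  sameOrient = pointwise (pointwise eqᵇ)

  sameOrient⇒≗ : {d : ℕ} {P O : Orient d} → sameOrient P O ≡ true → ∀ u w → P u w ≡ O u w
  sameOrient⇒≗ e u w = eqᵇ⇒≡ (pointwise-elim {E = eqᵇ} (pointwise-elim {E = pointwise eqᵇ} e u) w)

  ≗⇒sameOrient : {d : ℕ} {P O : Orient d} → (∀ u w → P u w ≡ O u w) → sameOrient P O ≡ true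
  ≗⇒sameOrient h = pointwise-intro {E = pointwise eqᵇ} (λ u → pointwise-intro {E = eqᵇ} (λ w → ≡⇒eqᵇ (h u w)))

  ∑-orientCandidates-indicator : (d : ℕ) (O : Orient d) →
    ∑ (λ P → ⟦ sameOrient P O ⟧) (allOrientCandidates d) ≡ 1
  ∑-orientCandidates-indicator d =
    ∑-allFuns-pointwise (pointwise eqᵇ) (allFuns bools d) (∑-allFuns-pointwise eqᵇ bools ∑-bools-indicator d) d

  module _ {d : ℕ} (z z⁻¹ : Fin d → Fin d) (z∘z⁻¹ : ∀ v → z (z⁻¹ v) ≡ v) (z⁻¹∘z : ∀ i → z⁻¹ (z i) ≡ i) where

    ∑-allFin-reindex : (h : Fin d → ℕ) → ∑ (h ∘ z) (allFin d) ≡ ∑ h (allFin d)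
    ∑-allFin-reindex h = begin
        ∑ (h ∘ z) (allFin d)
      ≡⟨ ∑-cong (λ i → sym (∑-allFin-point (z i) h)) (allFin d) ⟩
        ∑ (λ i → ∑ (λ v → ⟦ v == z i ⟧ * h v) (allFin d)) (allFin d)
      ≡⟨ ∑-comm (λ i v → ⟦ v == z i ⟧ * h v) (allFin d) (allFin d) ⟩
        ∑ (λ v → ∑ (λ i → ⟦ v == z i ⟧ * h v) (allFin d)) (allFin d)
      ≡⟨ ∑-cong (λ v → ∑-*ʳ (h v) (λ i → ⟦ v == z i ⟧) (allFin d)) (allFin d) ⟩
        ∑ (λ v → ∑ (λ i → ⟦ v == z i ⟧) (allFin d) * h v) (allFin d)
      ≡⟨ ∑-cong (λ v → cong (_* h v) (trans (∑-cong (λ i → cong ⟦_⟧ (flip-== v i)) (allFin d))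
                                            (∑-allFin-indicator (z⁻¹ v)))) (allFin d) ⟩
        ∑ (λ v → 1 * h v) (allFin d)
      ≡⟨ ∑-cong (λ v → *-identityˡ (h v)) (allFin d) ⟩
        ∑ h (allFin d)
      ∎
      where
      open ≡-Reasoning
      flip-== : ∀ v i → (v == z i) ≡ (i == z⁻¹ v)
      flip-== v i = true⇔true⇒≡ (λ p → ≡⇒== (trans (sym (z⁻¹∘z i)) (cong z⁻¹ (sym (==⇒≡ p)))))
                               (λ p → ≡⇒== (trans (sym (z∘z⁻¹ v)) (cong z (sym (==⇒≡ p)))))

    ∑-allFuns-reindex : (N : ℕ) (Q : (Fin d → Fin N) → Bool) → (∀ g g′ → (∀ i → g i ≡ g′ i) → Q g ≡ Q g′) →
      ∑ (λ f → ⟦ Q (f ∘ z) ⟧) (allFuns (allFin N) d) ≡ ∑ (λ g → ⟦ Q g ⟧) (allFuns (allFin N) d)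
    ∑-allFuns-reindex N Q Q-ext = begin
        ∑ (λ f → ⟦ Q (f ∘ z) ⟧) L
      ≡⟨ ∑-cong (λ f → sym (∑-unique-point (λ g → sameFun g (f ∘ z)) (λ g → ⟦ Q g ⟧) ⟦ Q (f ∘ z) ⟧ L
                              (λ g p → cong ⟦_⟧ (Q-ext g (f ∘ z) (sameFun⇒≗ p)))
                              (∑-allFuns-indicator d N (f ∘ z)))) L ⟩
        ∑ (λ f → ∑ (λ g → ⟦ sameFun g (f ∘ z) ⟧ * ⟦ Q g ⟧) L) L
      ≡⟨ ∑-comm (λ f g → ⟦ sameFun g (f ∘ z) ⟧ * ⟦ Q g ⟧) L L ⟩
        ∑ (λ g → ∑ (λ f → ⟦ sameFun g (f ∘ z) ⟧ * ⟦ Q g ⟧) L) L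
      ≡⟨ ∑-cong (λ g → ∑-*ʳ ⟦ Q g ⟧ (λ f → ⟦ sameFun g (f ∘ z) ⟧) L) L ⟩
        ∑ (λ g → ∑ (λ f → ⟦ sameFun g (f ∘ z) ⟧) L * ⟦ Q g ⟧) L
      ≡⟨ ∑-cong (λ g → cong (_* ⟦ Q g ⟧) (trans (∑-cong (λ f → cong ⟦_⟧ (transpose g f)) L)
                                                (∑-allFuns-indicator d N (g ∘ z⁻¹)))) L ⟩
        ∑ (λ g → 1 * ⟦ Q g ⟧) L
      ≡⟨ ∑-cong (λ g → *-identityˡ ⟦ Q g ⟧) L ⟩
        ∑ (λ g → ⟦ Q g ⟧) L
      ∎
      where
      open ≡-Reasoning
      L = allFuns (allFin N) d
      transpose : ∀ g f → sameFun g (f ∘ z) ≡ sameFun f (g ∘ z⁻¹)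
      transpose g f = true⇔true⇒≡
        (λ p → ≗⇒sameFun (λ v → trans (cong f (sym (z∘z⁻¹ v))) (sym (sameFun⇒≗ p (z⁻¹ v)))))
        (λ p → ≗⇒sameFun (λ i → trans (sym (cong g (z⁻¹∘z i))) (sym (sameFun⇒≗ p (z i)))))

  inv1-q^suc-small : (d j : ℕ) → 0 < j → j < suc d → inv1-q^suc d j ≡ 0
  inv1-q^suc-small d (suc j) _ j<d rewrite m<n⇒m%n≡m {n = suc d} {m = suc j} j<d = refl

  inv1-q^suc-periodic : (d j : ℕ) → inv1-q^suc d (j + suc d) ≡ inv1-q^suc d j
  inv1-q^suc-periodic d j = cong (λ r → if r ≡ᵇ 0 then 1 else 0) ([m+n]%n≡m%n j (suc d))

  ⊛≡∑< : (h g : Series) (T : ℕ) → (h ⊛ g) T ≡ ∑< (suc T) (λ k → h k * g (T ∸ k))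
  ⊛≡∑< h g T = trans (sum-map≡∑ _ (upTo (suc T))) (∑-upTo _ (suc T))

  ⊛-inv1-q^suc-below : (h : Series) (d T : ℕ) → T < suc d → (h ⊛ inv1-q^suc d) T ≡ h T
  ⊛-inv1-q^suc-below h d T T≤d = begin
      (h ⊛ inv1-q^suc d) T
    ≡⟨ ⊛≡∑< h (inv1-q^suc d) T ⟩
      ∑< (suc T) (λ k → h k * inv1-q^suc d (T ∸ k))
    ≡⟨ ∑<-last T _ vanish ⟩
      h T * inv1-q^suc d (T ∸ T)
    ≡⟨ cong (λ x → h T * inv1-q^suc d x) (n∸n≡0 T) ⟩
      h T * 1
    ≡⟨ *-identityʳ (h T) ⟩
      h T
    ∎
    where
    open ≡-Reasoning
    vanish : ∀ k → k < T → h k * inv1-q^suc d (T ∸ k) ≡ 0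
    vanish k k<T = trans (cong (h k *_) (inv1-q^suc-small d (T ∸ k) (m<n⇒0<n∸m k<T) (≤-<-trans (m∸n≤m T k) T≤d)))
                         (*-zeroʳ (h k))

  ⊛-inv1-q^suc-step : (h : Series) (d T : ℕ) →
    (h ⊛ inv1-q^suc d) (suc d + T) ≡ h (suc d + T) + (h ⊛ inv1-q^suc d) T
  ⊛-inv1-q^suc-step h d T = begin
      (h ⊛ inv1-q^suc d) (suc d + T)
    ≡⟨ ⊛≡∑< h (inv1-q^suc d) (suc d + T) ⟩
      ∑< (suc (suc d + T)) f
    ≡⟨ cong (λ z → ∑< z f) (cong suc (trans (cong suc (+-comm d T)) (sym (+-suc T d)))) ⟩
      ∑< (suc T + suc d) f
    ≡⟨ ∑<-+ (suc T) (suc d) f ⟩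
      ∑< (suc T) f + ∑< (suc d) (λ i → f (suc T + i))
    ≡⟨ cong₂ _+_ (∑<-cong (suc T) periodic) (∑<-last d _ vanish) ⟩
      ∑< (suc T) (λ k → h k * inv1-q^suc d (T ∸ k)) + f (suc T + d)
    ≡⟨ cong₂ _+_ (sym (⊛≡∑< h (inv1-q^suc d) T)) last ⟩
      (h ⊛ inv1-q^suc d) T + h (suc d + T)
    ≡⟨ +-comm ((h ⊛ inv1-q^suc d) T) (h (suc d + T)) ⟩
      h (suc d + T) + (h ⊛ inv1-q^suc d) T
    ∎
    where
    open ≡-Reasoning
    f : ℕ → ℕ
    f k = h k * inv1-q^suc d (suc d + T ∸ k)
    periodic : ∀ k → k < suc T → f k ≡ h k * inv1-q^suc d (T ∸ k)
    periodic k (s≤s k≤T) =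
      cong (h k *_) (trans (cong (inv1-q^suc d) (trans (+-∸-assoc (suc d) k≤T) (+-comm (suc d) (T ∸ k))))
                           (inv1-q^suc-periodic d (T ∸ k)))
    tail-index : ∀ i → suc d + T ∸ (suc T + i) ≡ d ∸ i
    tail-index i = trans (cong (_∸ (T + i)) (+-comm d T)) ([m+n]∸[m+o]≡n∸o T d i)
    vanish : ∀ k → k < d → f (suc T + k) ≡ 0
    vanish k k<d =
      trans (cong (λ z → h (suc T + k) * inv1-q^suc d z) (tail-index k))
            (trans (cong (h (suc T + k) *_) (inv1-q^suc-small d (d ∸ k) (m<n⇒0<n∸m k<d) (s≤s (m∸n≤m d k))))
                   (*-zeroʳ (h (suc T + k))))
    last : f (suc T + d) ≡ h (suc d + T)
    last = trans (cong (λ z → h (suc T + d) * inv1-q^suc d z) (trans (tail-index d) (n∸n≡0 d)))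
                 (trans (*-identityʳ _) (cong h (cong suc (+-comm T d))))

  ∑-multiples≡⊛-inv1-q^suc : (h : Series) (d K T : ℕ) → T < K →
    ∑< K (λ j → ⟦ suc d * j ≤ᵇ T ⟧ * h (T ∸ suc d * j)) ≡ (h ⊛ inv1-q^suc d) T
  ∑-multiples≡⊛-inv1-q^suc h d (suc K) T T<K with suc d ≤? T
  ... | no d≥T =
    trans (cong₂ _+_ first (∑<-zero K _ rest))
          (trans (+-identityʳ (h T)) (sym (⊛-inv1-q^suc-below h d T (≰⇒> d≥T))))
    where
    first : ⟦ suc d * 0 ≤ᵇ T ⟧ * h (T ∸ suc d * 0) ≡ h T
    first rewrite *-zeroʳ d = +-identityʳ (h T)
    rest : ∀ j → ⟦ suc d * suc j ≤ᵇ T ⟧ * h (T ∸ suc d * suc j) ≡ 0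
    rest j = ⟦false⟧* _ (≰⇒≤ᵇ-false (λ p → d≥T (≤-trans (m≤m*n (suc d) (suc j)) p)))
  ... | yes d<T with m≤n⇒∃[o]m+o≡n d<T
  ...   | T′ , refl =
    trans (cong₂ _+_ first (trans (∑<-cong K shift) (∑-multiples≡⊛-inv1-q^suc h d K T′ T′<K)))
          (sym (⊛-inv1-q^suc-step h d T′))
    where
    first : ⟦ suc d * 0 ≤ᵇ suc d + T′ ⟧ * h (suc d + T′ ∸ suc d * 0) ≡ h (suc d + T′)
    first rewrite *-zeroʳ d = +-identityʳ _
    T′<K : T′ < K
    T′<K = ≤-trans (s≤s (m≤n+m T′ d)) (≤-pred T<K)
    shift : ∀ j → j < K →
      ⟦ suc d * suc j ≤ᵇ suc d + T′ ⟧ * h (suc d + T′ ∸ suc d * suc j) ≡ ⟦ suc d * j ≤ᵇ T′ ⟧ * h (T′ ∸ suc d * j)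
    shift j _ =
      trans (cong (λ z → ⟦ z ≤ᵇ suc d + T′ ⟧ * h (suc d + T′ ∸ z)) (*-suc (suc d) j))
      (trans (cong (λ z → ⟦ suc d + suc d * j ≤ᵇ suc d + T′ ⟧ * h z) ([m+n]∸[m+o]≡n∸o (suc d) T′ (suc d * j)))
             (cong (λ b → ⟦ b ⟧ * h (T′ ∸ suc d * j))
                   (true⇔true⇒≡ (λ e → ≤⇒≤ᵇ-true (+-cancelˡ-≤ (suc d) _ _ (≤ᵇ-true⇒≤ {suc d + suc d * j} e)))
                                (λ e → ≤⇒≤ᵇ-true (+-monoʳ-≤ (suc d) (≤ᵇ-true⇒≤ {suc d * j} e))))))

  shiftedInvDen : ℕ → ℕ → Series
  shiftedInvDen d e n = ⟦ e ≤ᵇ n ⟧ * invDen d (n ∸ e)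

  fromExponents-⊛ : {A : Set} (ex : A → ℕ) (L : List A) (g : Series) (N : ℕ) →
    (fromExponents (map ex L) ⊛ g) N ≡ ∑ (λ p → ⟦ ex p ≤ᵇ N ⟧ * g (N ∸ ex p)) L
  fromExponents-⊛ ex L g N = begin
      (fromExponents (map ex L) ⊛ g) N
    ≡⟨ ⊛≡∑< (fromExponents (map ex L)) g N ⟩
      ∑< (suc N) (λ k → fromExponents (map ex L) k * g (N ∸ k))
    ≡⟨ ∑<-cong (suc N) (λ k _ → cong (_* g (N ∸ k)) (count k)) ⟩
      ∑< (suc N) (λ k → ∑ (λ p → ⟦ ex p ≡ᵇ k ⟧) L * g (N ∸ k))
    ≡⟨ ∑<-cong (suc N) (λ k _ → sym (∑-*ʳ (g (N ∸ k)) (λ p → ⟦ ex p ≡ᵇ k ⟧) L)) ⟩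
      ∑< (suc N) (λ k → ∑ (λ p → ⟦ ex p ≡ᵇ k ⟧ * g (N ∸ k)) L)
    ≡⟨ sym (∑-upTo _ (suc N)) ⟩
      ∑ (λ k → ∑ (λ p → ⟦ ex p ≡ᵇ k ⟧ * g (N ∸ k)) L) (upTo (suc N))
    ≡⟨ ∑-comm (λ k p → ⟦ ex p ≡ᵇ k ⟧ * g (N ∸ k)) (upTo (suc N)) L ⟩
      ∑ (λ p → ∑ (λ k → ⟦ ex p ≡ᵇ k ⟧ * g (N ∸ k)) (upTo (suc N))) L
    ≡⟨ ∑-cong (λ p → trans (∑-upTo _ (suc N)) (∑<-indicator (suc N) (ex p) (λ k → g (N ∸ k)))) L ⟩
      ∑ (λ p → ⟦ ex p <ᵇ suc N ⟧ * g (N ∸ ex p)) L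
    ≡⟨ ∑-cong (λ p → <ᵇ-suc (ex p)) L ⟩
      ∑ (λ p → ⟦ ex p ≤ᵇ N ⟧ * g (N ∸ ex p)) L
    ∎
    where
    open ≡-Reasoning
    count : ∀ k → fromExponents (map ex L) k ≡ ∑ (λ p → ⟦ ex p ≡ᵇ k ⟧) L
    count k = trans (length-filter≡∑ (_≡ᵇ k) (map ex L)) (∑-map (λ e → ⟦ e ≡ᵇ k ⟧) ex L)
    <ᵇ-suc : ∀ e → ⟦ e <ᵇ suc N ⟧ * g (N ∸ e) ≡ ⟦ e ≤ᵇ N ⟧ * g (N ∸ e)
    <ᵇ-suc zero = refl
    <ᵇ-suc (suc e) = refl

  firstStep : (cmp : ℕ → ℕ → Bool) {d : ℕ} → (Fin (suc d) → ℕ) → ℕ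
  firstStep cmp {zero} σ = 0
  firstStep cmp {suc d} σ = ⟦ cmp (σ fzero) (σ (fsuc fzero)) ⟧

  isRising : (cmp : ℕ → ℕ → Bool) {d : ℕ} → ℕ → (Fin d → ℕ) → (Fin d → ℕ) → Bool
  isRising cmp {zero} lo σ g = true
  isRising cmp {suc d} lo σ g = (lo ≤ᵇ g fzero) ∧ isRising cmp (g fzero + firstStep cmp σ) (σ ∘ fsuc) (g ∘ fsuc)

  Rises : (cmp : ℕ → ℕ → Bool) {d : ℕ} → (Fin d → ℕ) → (Fin d → ℕ) → Set
  Rises cmp σ g = ∀ i j → toℕ j ≡ suc (toℕ i) → g i + ⟦ cmp (σ i) (σ j) ⟧ ≤ g j

  isRising⇒Rises : (cmp : ℕ → ℕ → Bool) {d : ℕ} (lo : ℕ) (σ g : Fin d → ℕ) →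
    isRising cmp lo σ g ≡ true → Rises cmp σ g
  isRising⇒Rises cmp {suc (suc d)} lo σ g e fzero (fsuc fzero) _ = ≤ᵇ-true⇒≤ (∧-elimˡ (∧-elimʳ {lo ≤ᵇ g fzero} e))
  isRising⇒Rises cmp {suc d} lo σ g e (fsuc i) (fsuc j) p =
    isRising⇒Rises cmp (g fzero + firstStep cmp σ) (σ ∘ fsuc) (g ∘ fsuc) (∧-elimʳ {lo ≤ᵇ g fzero} e) i j
        (suc-injective p)
  isRising⇒Rises cmp {suc d} lo σ g e fzero fzero ()
  isRising⇒Rises cmp {suc (suc d)} lo σ g e fzero (fsuc (fsuc j)) ()

  Rises⇒isRising : (cmp : ℕ → ℕ → Bool) {d : ℕ} (lo : ℕ) (σ g : Fin d → ℕ) →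
    (∀ i → toℕ i ≡ 0 → lo ≤ g i) → Rises cmp σ g → isRising cmp lo σ g ≡ true
  Rises⇒isRising cmp {zero} lo σ g start r = refl
  Rises⇒isRising cmp {suc zero} lo σ g start r = ∧-intro (≤⇒≤ᵇ-true (start fzero refl)) refl
  Rises⇒isRising cmp {suc (suc d)} lo σ g start r =
    ∧-intro (≤⇒≤ᵇ-true (start fzero refl))
            (Rises⇒isRising cmp (g fzero + firstStep cmp σ) (σ ∘ fsuc) (g ∘ fsuc) start′
                            (λ i j p → r (fsuc i) (fsuc j) (cong suc p)))
    where
    start′ : ∀ (i : Fin (suc d)) → toℕ i ≡ 0 → g fzero + firstStep cmp σ ≤ g (fsuc i)
    start′ fzero _ = r fzero (fsuc fzero) refl

  isRising-cong : (cmp : ℕ → ℕ → Bool) {d : ℕ} (lo : ℕ) (σ g g′ : Fin d → ℕ) →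
    (∀ i → g i ≡ g′ i) → isRising cmp lo σ g ≡ isRising cmp lo σ g′
  isRising-cong cmp {zero} lo σ g g′ e = refl
  isRising-cong cmp {suc d} lo σ g g′ e rewrite e fzero =
    cong ((lo ≤ᵇ g′ fzero) ∧_) (isRising-cong cmp (g′ fzero + firstStep cmp σ) (σ ∘ fsuc) (g ∘ fsuc)
        (g′ ∘ fsuc) (e ∘ fsuc))

  comaj : (cmp : ℕ → ℕ → Bool) {d : ℕ} → (Fin d → ℕ) → ℕ
  comaj cmp {zero} σ = 0
  comaj cmp {suc d} σ = firstStep cmp σ * d + comaj cmp (σ ∘ fsuc)

  total : {d N : ℕ} → (Fin d → Fin N) → ℕ
  total {d} f = ∑ (partOf f) (allFin d)

  countWithTotal : (d N : ℕ) → ((Fin d → Fin N) → Bool) → ℕ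
  countWithTotal d N P = ∑ (λ f → ⟦ total f ≡ᵇ N ⟧ * ⟦ P f ⟧) (allFuns (allFin N) d)

  countRising : (cmp : ℕ → ℕ → Bool) (N d : ℕ) → ℕ → (Fin d → ℕ) → ℕ → ℕ
  countRising cmp N d lo σ n =
    ∑ (λ g → ⟦ isRising cmp lo σ (toℕ ∘ g) ∧ (total g ≡ᵇ n) ⟧) (allFuns (allFin N) d)

  +≡ᵇ-split : (c s n : ℕ) → (c + s ≡ᵇ n) ≡ (c ≤ᵇ n) ∧ (s ≡ᵇ n ∸ c)
  +≡ᵇ-split c s n = true⇔true⇒≡
    (λ e → ∧-intro (≤⇒≤ᵇ-true (subst (c ≤_) (≡ᵇ-true⇒≡ e) (m≤m+n c s)))
                   (≡⇒≡ᵇ-true (trans (sym (m+n∸m≡n c s)) (cong (_∸ c) (≡ᵇ-true⇒≡ e)))))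
    (λ e → ≡⇒≡ᵇ-true (trans (cong (c +_) (≡ᵇ-true⇒≡ (∧-elimʳ {c ≤ᵇ n} e))) (m+[n∸m]≡n (≤ᵇ-true⇒≤ {c} {n} (∧-elimˡ e)))))

  ⟦∧∧⟧ : (a i b e : Bool) → ⟦ (a ∧ i) ∧ (b ∧ e) ⟧ ≡ ⟦ a ⟧ * (⟦ b ⟧ * ⟦ i ∧ e ⟧)
  ⟦∧∧⟧ true true true true = refl
  ⟦∧∧⟧ true true true false = refl
  ⟦∧∧⟧ true false true e = refl
  ⟦∧∧⟧ true true false e = refl
  ⟦∧∧⟧ true false false e = refl
  ⟦∧∧⟧ false i b e = refl

  ⟦≤ᵇ⟧-∸ : (p q n z : ℕ) → ⟦ p ≤ᵇ n ⟧ * (⟦ q ≤ᵇ n ∸ p ⟧ * z) ≡ ⟦ p + q ≤ᵇ n ⟧ * z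
  ⟦≤ᵇ⟧-∸ p q n z with p ≤? n
  ... | no p≰n = trans (⟦false⟧* _ (≰⇒≤ᵇ-false p≰n))
                       (sym (⟦false⟧* z (≰⇒≤ᵇ-false (λ h → p≰n (≤-trans (m≤m+n p q) h)))))
  ... | yes p≤n = trans (⟦true⟧* _ (≤⇒≤ᵇ-true p≤n)) (cong (λ b → ⟦ b ⟧ * z) (true⇔true⇒≡ to from))
    where
    to : (q ≤ᵇ n ∸ p) ≡ true → (p + q ≤ᵇ n) ≡ true
    to e = ≤⇒≤ᵇ-true (subst (p + q ≤_) (m+[n∸m]≡n p≤n) (+-monoʳ-≤ p (≤ᵇ-true⇒≤ e)))
    from : (p + q ≤ᵇ n) ≡ true → (q ≤ᵇ n ∸ p) ≡ true
    from e = ≤⇒≤ᵇ-true (subst (_≤ n ∸ p) (m+n∸m≡n p q) (∸-monoˡ-≤ p (≤ᵇ-true⇒≤ {p + q} e)))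

  1+lo≤1+d+[1+d]lo+r : (d lo r : ℕ) → suc lo ≤ suc d + suc d * lo + r
  1+lo≤1+d+[1+d]lo+r d lo r = ≤-trans (≤-trans (m≤n*m (suc lo) (suc d)) (≤-reflexive (*-suc (suc d) lo))) (m≤m+n _ r)

  ∑-shifted-multiples : (d E K n : ℕ) → n < E + K →
    ∑< K (λ j → shiftedInvDen d (E + suc d * j) n) ≡ shiftedInvDen (suc d) E n
  ∑-shifted-multiples d E K n n<E+K with E ≤? n
  ... | no E≰n =
    trans (∑<-zero K _ (λ j → ⟦false⟧* _ (≰⇒≤ᵇ-false (λ p → E≰n (≤-trans (m≤m+n E _) p)))))
          (sym (⟦false⟧* _ (≰⇒≤ᵇ-false E≰n)))
  ... | yes E≤n with m≤n⇒∃[o]m+o≡n E≤n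
  ...   | T , refl = begin
      ∑< K (λ j → shiftedInvDen d (E + suc d * j) (E + T))
    ≡⟨ ∑<-cong K (λ j _ → cancel j) ⟩
      ∑< K (λ j → ⟦ suc d * j ≤ᵇ T ⟧ * invDen d (T ∸ suc d * j))
    ≡⟨ ∑-multiples≡⊛-inv1-q^suc (invDen d) d K T (+-cancelˡ-< E T K n<E+K) ⟩
      invDen (suc d) T
    ≡⟨ cong (invDen (suc d)) (sym (m+n∸m≡n E T)) ⟩
      invDen (suc d) (E + T ∸ E)
    ≡⟨ sym (⟦true⟧* _ (≤⇒≤ᵇ-true (m≤m+n E T))) ⟩
      shiftedInvDen (suc d) E (E + T)
    ∎
    where
    open ≡-Reasoning
    cancel : ∀ j → shiftedInvDen d (E + suc d * j) (E + T) ≡ ⟦ suc d * j ≤ᵇ T ⟧ * invDen d (T ∸ suc d * j)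
    cancel j =
      trans (cong (⟦ E + suc d * j ≤ᵇ E + T ⟧ *_) (cong (invDen d) ([m+n]∸[m+o]≡n∸o E T (suc d * j))))
            (cong (λ b → ⟦ b ⟧ * invDen d (T ∸ suc d * j))
                  (true⇔true⇒≡ (λ e → ≤⇒≤ᵇ-true (+-cancelˡ-≤ E _ _ (≤ᵇ-true⇒≤ {E + suc d * j} e)))
                               (λ e → ≤⇒≤ᵇ-true (+-monoʳ-≤ E (≤ᵇ-true⇒≤ {suc d * j} e)))))

  ∑-first-part : (d lo r n N : ℕ) → n ≤ N →
    ∑< N (λ x → ⟦ lo ≤ᵇ x ⟧ * shiftedInvDen d (suc d * suc x + r) n) ≡ shiftedInvDen (suc d) (suc d + suc d * lo + r) n
  ∑-first-part d lo r n N n≤N with lo ≤? N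
  ... | no lo≰N =
    trans (∑<-cong N (λ x x<N → ⟦false⟧* _ (≰⇒≤ᵇ-false (λ p → lo≰N (≤-trans p (<⇒≤ x<N))))))
          (trans (∑<-zero N (λ _ → 0) (λ _ → refl)) (sym (⟦false⟧* _ (≰⇒≤ᵇ-false E≰n))))
    where
    E≰n : suc d + suc d * lo + r ≰ n
    E≰n p = lo≰N (≤-trans (≤-trans (n≤1+n lo) (1+lo≤1+d+[1+d]lo+r d lo r)) (≤-trans p n≤N))
  ... | yes lo≤N with m≤n⇒∃[o]m+o≡n lo≤N
  ...   | K , refl = begin
      ∑< (lo + K) ψ
    ≡⟨ ∑<-+ lo K ψ ⟩
      ∑< lo ψ + ∑< K (λ j → ψ (lo + j))
    ≡⟨ cong₂ _+_ (trans (∑<-cong lo (λ x x<lo → ⟦false⟧* _ (≰⇒≤ᵇ-false (<⇒≱ x<lo))))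
        (∑<-zero lo (λ _ → 0) (λ _ → refl)))
                 (∑<-cong K (λ j _ → shift j)) ⟩
      0 + ∑< K (λ j → shiftedInvDen d (E + suc d * j) n)
    ≡⟨ ∑-shifted-multiples d E K n (≤-trans (s≤s n≤N) (+-monoˡ-≤ K (1+lo≤1+d+[1+d]lo+r d lo r))) ⟩
      shiftedInvDen (suc d) E n
    ∎
    where
    open ≡-Reasoning
    E = suc d + suc d * lo + r
    ψ : ℕ → ℕ
    ψ x = ⟦ lo ≤ᵇ x ⟧ * shiftedInvDen d (suc d * suc x + r) n
    exponent : ∀ j → suc d * suc (lo + j) + r ≡ E + suc d * j
    exponent = solve 4 (λ d lo r j → (con 1 :+ d) :* (con 1 :+ (lo :+ j)) :+ r
                                   := (con 1 :+ d) :+ (con 1 :+ d) :* lo :+ r :+ (con 1 :+ d) :* j) refl d lo r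
      where open +-*-Solver
    shift : ∀ j → ψ (lo + j) ≡ shiftedInvDen d (E + suc d * j) n
    shift j = trans (⟦true⟧* _ (≤⇒≤ᵇ-true (m≤m+n lo j))) (cong (λ e → shiftedInvDen d e n) (exponent j))

  shiftedInvDen-shift : (d p e n : ℕ) → ⟦ p ≤ᵇ n ⟧ * shiftedInvDen d e (n ∸ p) ≡ shiftedInvDen d (p + e) n
  shiftedInvDen-shift d p e n =
    trans (cong (λ m → ⟦ p ≤ᵇ n ⟧ * (⟦ e ≤ᵇ n ∸ p ⟧ * invDen d m)) (∸-+-assoc n p e))
          (⟦≤ᵇ⟧-∸ p e n (invDen d (n ∸ (p + e))))

  ⟦isRising-∷⟧ : (cmp : ℕ → ℕ → Bool) {N d : ℕ} (lo : ℕ) (σ : Fin (suc d) → ℕ) (n : ℕ) (x : Fin N) (g : Fin d → Fin N) →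
    ⟦ isRising cmp lo σ (toℕ ∘ (x VF.∷ g)) ∧ (total (x VF.∷ g) ≡ᵇ n) ⟧
    ≡ ⟦ lo ≤ᵇ toℕ x ⟧ * (⟦ suc (toℕ x) ≤ᵇ n ⟧
      * ⟦ isRising cmp (toℕ x + firstStep cmp σ) (σ ∘ fsuc) (toℕ ∘ g) ∧ (total g ≡ᵇ n ∸ suc (toℕ x)) ⟧)
  ⟦isRising-∷⟧ cmp {d = d} lo σ n x g =
    trans (cong (λ s → ⟦ isRising cmp lo σ (toℕ ∘ (x VF.∷ g)) ∧ s ⟧)
                (trans (cong (_≡ᵇ n) (∑-allFin-suc d (partOf (x VF.∷ g))))
                       (+≡ᵇ-split (suc (toℕ x)) (total g) n)))
          (⟦∧∧⟧ (lo ≤ᵇ toℕ x) (isRising cmp (toℕ x + firstStep cmp σ) (σ ∘ fsuc) (toℕ ∘ g)) (suc (toℕ x) ≤ᵇ n) _)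

  -- Fixing the first value x ≥ lo leaves a sequence rising from x + firstStep; summing over x
  -- then multiplies by 1/(1-q^(d+1)).
  countRising≡shiftedInvDen : (cmp : ℕ → ℕ → Bool) (N d lo : ℕ) (σ : Fin d → ℕ) (n : ℕ) → n ≤ N →
    countRising cmp N d lo σ n ≡ shiftedInvDen d (d + d * lo + comaj cmp σ) n
  countRising≡shiftedInvDen cmp N zero lo σ zero _ = refl
  countRising≡shiftedInvDen cmp N zero lo σ (suc n) _ = refl
  countRising≡shiftedInvDen cmp N (suc d) lo σ n n≤N = begin
      countRising cmp N (suc d) lo σ n
    ≡⟨ ∑-allFuns-suc (allFin N) d _ ⟩
      ∑ (λ x → ∑ (λ g → ⟦ isRising cmp lo σ (toℕ ∘ (x VF.∷ g)) ∧ (total (x VF.∷ g) ≡ᵇ n) ⟧) Fs)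
        (allFin N)
    ≡⟨ ∑-cong first-value (allFin N) ⟩
      ∑ (ψ ∘ toℕ) (allFin N)
    ≡⟨ ∑-allFin-toℕ N ψ ⟩
      ∑< N ψ
    ≡⟨ ∑<-cong N (λ x _ → cong (⟦ lo ≤ᵇ x ⟧ *_) (trans (shiftedInvDen-shift d (suc x) (tail-exponent x) n)
                                                      (cong (λ e → shiftedInvDen d e n) (exponent x d a w)))) ⟩
      ∑< N (λ x → ⟦ lo ≤ᵇ x ⟧ * shiftedInvDen d (suc d * suc x + (a * d + w)) n)
    ≡⟨ ∑-first-part d lo (a * d + w) n N n≤N ⟩
      shiftedInvDen (suc d) (suc d + suc d * lo + (a * d + w)) n
    ∎
    where
    open ≡-Reasoning
    a = firstStep cmp σ
    w = comaj cmp (σ ∘ fsuc)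
    Fs = allFuns (allFin N) d
    tail-exponent : ℕ → ℕ
    tail-exponent x = d + d * (x + a) + w
    ψ : ℕ → ℕ
    ψ x = ⟦ lo ≤ᵇ x ⟧ * (⟦ suc x ≤ᵇ n ⟧ * shiftedInvDen d (tail-exponent x) (n ∸ suc x))
    first-value : ∀ x → ∑ (λ g → ⟦ isRising cmp lo σ (toℕ ∘ (x VF.∷ g)) ∧ (total (x VF.∷ g) ≡ᵇ n) ⟧) Fs
                        ≡ ψ (toℕ x)
    first-value x =
      trans (∑-cong (⟦isRising-∷⟧ cmp lo σ n x) Fs)
      (trans (∑-*ˡ ⟦ lo ≤ᵇ toℕ x ⟧ _ Fs)
      (cong (⟦ lo ≤ᵇ toℕ x ⟧ *_)
            (trans (∑-*ˡ ⟦ suc (toℕ x) ≤ᵇ n ⟧ _ Fs)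
                   (cong (⟦ suc (toℕ x) ≤ᵇ n ⟧ *_)
                         (countRising≡shiftedInvDen cmp N d (toℕ x + a) (σ ∘ fsuc) (n ∸ suc (toℕ x))
                                                    (≤-trans (m∸n≤m n (suc (toℕ x))) n≤N))))))
    exponent : ∀ x d a w → suc x + (d + d * (x + a) + w) ≡ suc d * suc x + (a * d + w)
    exponent = solve 4 (λ x d a w → (con 1 :+ x) :+ (d :+ d :* (x :+ a) :+ w)
                                  := (con 1 :+ d) :* (con 1 :+ x) :+ (a :* d :+ w)) refl
      where open +-*-Solver

  map-allFin-suc : {A : Set} {d : ℕ} (τ : Fin (suc d) → A) →
    map τ (allFin (suc d)) ≡ τ fzero ∷ map (τ ∘ fsuc) (allFin d)
  map-allFin-suc τ = cong (τ fzero ∷_) (trans (map-tabulate fsuc τ) (sym (map-tabulate id (τ ∘ fsuc))))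

  map-allFin-suc-last : {A : Set} (d : ℕ) (h : Fin (suc d) → A) →
    map h (allFin (suc d)) ≡ map (h ∘ inject₁) (allFin d) ++ h (fromℕ d) ∷ []
  map-allFin-suc-last zero h = refl
  map-allFin-suc-last (suc d) h =
    trans (map-allFin-suc h)
          (trans (cong (h fzero ∷_) (map-allFin-suc-last d (h ∘ fsuc)))
                 (cong (_++ h (fromℕ (suc d)) ∷ []) (sym (map-allFin-suc (h ∘ inject₁)))))

  map-opposite-allFin : {A : Set} (d : ℕ) (h : Fin d → A) → map (h ∘ opposite) (allFin d) ≡ reverse (map h (allFin d))
  map-opposite-allFin zero h = refl
  map-opposite-allFin (suc d) h = begin
      map (h ∘ opposite) (allFin (suc d))
    ≡⟨ map-allFin-suc (h ∘ opposite) ⟩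
      h (fromℕ d) ∷ map (h ∘ inject₁ ∘ opposite) (allFin d)
    ≡⟨ cong (h (fromℕ d) ∷_) (map-opposite-allFin d (h ∘ inject₁)) ⟩
      h (fromℕ d) ∷ reverse (map (h ∘ inject₁) (allFin d))
    ≡⟨ sym (reverse-++ (map (h ∘ inject₁) (allFin d)) (h (fromℕ d) ∷ [])) ⟩
      reverse (map (h ∘ inject₁) (allFin d) ++ h (fromℕ d) ∷ [])
    ≡⟨ cong reverse (sym (map-allFin-suc-last d h)) ⟩
      reverse (map h (allFin (suc d)))
    ∎
    where open ≡-Reasoning

  length-map-allFin : {A : Set} {d : ℕ} (τ : Fin d → A) → length (map τ (allFin d)) ≡ d
  length-map-allFin {d = d} τ = trans (length-map τ (allFin d)) (length-tabulate id)

  firstStepL : (ℕ → ℕ → Bool) → ℕ → List ℕ → ℕ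
  firstStepL cmp a [] = 0
  firstStepL cmp a (b ∷ _) = ⟦ cmp a b ⟧

  comajL : (ℕ → ℕ → Bool) → List ℕ → ℕ
  comajL cmp [] = 0
  comajL cmp (a ∷ as) = firstStepL cmp a as * length as + comajL cmp as

  comaj≡comajL : (cmp : ℕ → ℕ → Bool) {d : ℕ} (τ : Fin d → ℕ) → comaj cmp τ ≡ comajL cmp (map τ (allFin d))
  comaj≡comajL cmp {zero} τ = refl
  comaj≡comajL cmp {suc d} τ =
    trans (cong₂ _+_ (cong₂ _*_ (firstStep≡firstStepL d τ) (sym (length-map-allFin (τ ∘ fsuc))))
                     (comaj≡comajL cmp (τ ∘ fsuc)))
          (sym (cong (comajL cmp) (map-allFin-suc τ)))
    where
    firstStep≡firstStepL : (d : ℕ) (τ : Fin (suc d) → ℕ) →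
      firstStep cmp τ ≡ firstStepL cmp (τ fzero) (map (τ ∘ fsuc) (allFin d))
    firstStep≡firstStepL zero τ = refl
    firstStep≡firstStepL (suc d) τ = sym (cong (firstStepL cmp (τ fzero)) (map-allFin-suc (τ ∘ fsuc)))

  majBy : (ℕ → ℕ → Bool) → ℕ → List ℕ → ℕ
  majBy cmp j [] = 0
  majBy cmp j (a ∷ []) = 0
  majBy cmp j (a ∷ b ∷ cs) = (if cmp a b then j else 0) + majBy cmp (suc j) (b ∷ cs)

  majFrom≡majBy : (j : ℕ) (ℓ : List ℕ) → majFrom j ℓ ≡ majBy (flip _<ᵇ_) j ℓ
  majFrom≡majBy j [] = refl
  majFrom≡majBy j (a ∷ []) = refl
  majFrom≡majBy j (a ∷ b ∷ cs) = cong ((if b <ᵇ a then j else 0) +_) (majFrom≡majBy (suc j) (b ∷ cs))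

  majBy-snoc : (cmp : ℕ → ℕ → Bool) (j : ℕ) (ℓ : List ℕ) (a b : ℕ) →
    majBy cmp j (ℓ ++ a ∷ b ∷ []) ≡ majBy cmp j (ℓ ++ a ∷ []) + (if cmp a b then j + length ℓ else 0)
  majBy-snoc cmp j [] a b = trans (+-identityʳ _) (cong (λ z → if cmp a b then z else 0) (sym (+-identityʳ j)))
  majBy-snoc cmp j (x ∷ []) a b with cmp x a | cmp a b
  ... | true | true = solve 1 (λ j → j :+ ((con 1 :+ j) :+ con 0) := (j :+ con 0) :+ (j :+ con 1)) refl j
    where open +-*-Solver
  ... | true | false = solve 1 (λ j → j :+ (con 0 :+ con 0) := (j :+ con 0) :+ con 0) refl j
    where open +-*-Solver
  ... | false | true = solve 1 (λ j → (con 1 :+ j) :+ con 0 := j :+ con 1) refl j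
    where open +-*-Solver
  ... | false | false = refl
  majBy-snoc cmp j (x ∷ y ∷ ℓ) a b = begin
      (if cmp x y then j else 0) + majBy cmp (suc j) (y ∷ ℓ ++ a ∷ b ∷ [])
    ≡⟨ cong ((if cmp x y then j else 0) +_) (majBy-snoc cmp (suc j) (y ∷ ℓ) a b) ⟩
      (if cmp x y then j else 0) + (majBy cmp (suc j) (y ∷ ℓ ++ a ∷ []) +
          (if cmp a b then suc j + length (y ∷ ℓ) else 0))
    ≡⟨ sym (+-assoc (if cmp x y then j else 0) _ _) ⟩
      majBy cmp j (x ∷ y ∷ ℓ ++ a ∷ []) + (if cmp a b then suc j + length (y ∷ ℓ) else 0)
    ≡⟨ cong (λ z → majBy cmp j (x ∷ y ∷ ℓ ++ a ∷ []) + (if cmp a b then z else 0)) (sym (+-suc j (suc (length ℓ)))) ⟩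
      majBy cmp j (x ∷ y ∷ ℓ ++ a ∷ []) + (if cmp a b then j + length (x ∷ y ∷ ℓ) else 0)
    ∎
    where open ≡-Reasoning

  majBy-reverse : (cmp : ℕ → ℕ → Bool) (ℓ : List ℕ) → majBy cmp 1 (reverse ℓ) ≡ comajL (flip cmp) ℓ
  majBy-reverse cmp [] = refl
  majBy-reverse cmp (a ∷ []) = refl
  majBy-reverse cmp (a ∷ b ∷ cs) = begin
      majBy cmp 1 (reverse (a ∷ b ∷ cs))
    ≡⟨ cong (majBy cmp 1) (trans (unfold-reverse a (b ∷ cs))
                                 (trans (cong (_∷ʳ a) (unfold-reverse b cs))
                                     (++-assoc (reverse cs) (b ∷ []) (a ∷ [])))) ⟩
      majBy cmp 1 (reverse cs ++ b ∷ a ∷ [])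
    ≡⟨ majBy-snoc cmp 1 (reverse cs) b a ⟩
      majBy cmp 1 (reverse cs ++ b ∷ []) + (if cmp b a then suc (length (reverse cs)) else 0)
    ≡⟨ cong₂ _+_ (trans (cong (majBy cmp 1) (sym (unfold-reverse b cs))) (majBy-reverse cmp (b ∷ cs)))
                 (last-step (cmp b a)) ⟩
      comajL (flip cmp) (b ∷ cs) + ⟦ cmp b a ⟧ * length (b ∷ cs)
    ≡⟨ +-comm (comajL (flip cmp) (b ∷ cs)) _ ⟩
      comajL (flip cmp) (a ∷ b ∷ cs)
    ∎
    where
    open ≡-Reasoning
    last-step : (x : Bool) → (if x then suc (length (reverse cs)) else 0) ≡ ⟦ x ⟧ * length (b ∷ cs)
    last-step true = trans (cong suc (length-reverse cs)) (sym (+-identityʳ _))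
    last-step false = refl

  maj-op≡comaj : {d : ℕ} (σ : Fin d → Fin d) → maj (op σ) ≡ comaj _<ᵇ_ (toℕ ∘ σ)
  maj-op≡comaj {d} σ = begin
      majFrom 1 (map (toℕ ∘ σ ∘ opposite) (allFin d))
    ≡⟨ majFrom≡majBy 1 (map (toℕ ∘ σ ∘ opposite) (allFin d)) ⟩
      majBy (flip _<ᵇ_) 1 (map (toℕ ∘ σ ∘ opposite) (allFin d))
    ≡⟨ cong (majBy (flip _<ᵇ_) 1) (map-opposite-allFin d (toℕ ∘ σ)) ⟩
      majBy (flip _<ᵇ_) 1 (reverse (map (toℕ ∘ σ) (allFin d)))
    ≡⟨ majBy-reverse (flip _<ᵇ_) (map (toℕ ∘ σ) (allFin d)) ⟩
      comajL _<ᵇ_ (map (toℕ ∘ σ) (allFin d))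
    ≡⟨ sym (comaj≡comajL _<ᵇ_ (toℕ ∘ σ)) ⟩
      comaj _<ᵇ_ (toℕ ∘ σ)
    ∎
    where open ≡-Reasoning

  AdjacentDistinct : List ℕ → Set
  AdjacentDistinct (a ∷ b ∷ cs) = ¬ a ≡ b × AdjacentDistinct (b ∷ cs)
  AdjacentDistinct _ = ⊤

  map-allFin-adjacentDistinct : {d : ℕ} (τ : Fin d → ℕ) → (∀ i j → τ i ≡ τ j → i ≡ j) →
    AdjacentDistinct (map τ (allFin d))
  map-allFin-adjacentDistinct {zero} τ inj = tt
  map-allFin-adjacentDistinct {suc zero} τ inj = tt
  map-allFin-adjacentDistinct {suc (suc d)} τ inj =
    subst AdjacentDistinct (sym (trans (map-allFin-suc τ) (cong (τ fzero ∷_) (map-allFin-suc (τ ∘ fsuc)))))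
      ((λ e → 0≢1 (inj fzero (fsuc fzero) e)) ,
       subst AdjacentDistinct (map-allFin-suc (τ ∘ fsuc))
             (map-allFin-adjacentDistinct (τ ∘ fsuc) (λ i j e → fsuc-injective (inj (fsuc i) (fsuc j) e))))
    where
    0≢1 : ¬ fzero ≡ fsuc {suc d} fzero
    0≢1 ()

  positionSum : ℕ → ℕ → ℕ
  positionSum j zero = 0
  positionSum j (suc zero) = 0
  positionSum j (suc (suc L)) = j + positionSum (suc j) (suc L)

  -- Each adjacent pair of distinct letters is either a descent or an ascent.
  majBy-descents+ascents : (j : ℕ) (ℓ : List ℕ) → AdjacentDistinct ℓ →
    majBy (flip _<ᵇ_) j ℓ + majBy _<ᵇ_ j ℓ ≡ positionSum j (length ℓ)
  majBy-descents+ascents j [] _ = refl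
  majBy-descents+ascents j (a ∷ []) _ = refl
  majBy-descents+ascents j (a ∷ b ∷ cs) (a≢b , rest) =
    trans (exactly-one (b <ᵇ a) (a <ᵇ b) (majBy (flip _<ᵇ_) (suc j) (b ∷ cs)) (majBy _<ᵇ_ (suc j) (b ∷ cs)) one)
          (cong (j +_) (majBy-descents+ascents (suc j) (b ∷ cs) rest))
    where
    exactly-one : (x y : Bool) (p q : ℕ) → ⟦ x ⟧ + ⟦ y ⟧ ≡ 1 →
      (if x then j else 0) + p + ((if y then j else 0) + q) ≡ j + (p + q)
    exactly-one true false p q _ = +-assoc j p q
    exactly-one false true p q _ = trans (+-comm p (j + q)) (trans (+-assoc j q p) (cong (j +_) (+-comm q p)))
    one : ⟦ b <ᵇ a ⟧ + ⟦ a <ᵇ b ⟧ ≡ 1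
    one with <-cmp a b
    ... | tri< a<b _ _ = cong₂ _+_ (cong ⟦_⟧ (¬true⇒false (λ e → <-asym a<b (<ᵇ-true⇒< e)))) (cong ⟦_⟧ (<⇒<ᵇ-true a<b))
    ... | tri≈ _ a=b _ = ⊥-elim (a≢b a=b)
    ... | tri> _ _ b<a = cong₂ _+_ (cong ⟦_⟧ (<⇒<ᵇ-true b<a)) (cong ⟦_⟧ (¬true⇒false (λ e → <-asym b<a (<ᵇ-true⇒< e))))

  positionSum-suc : (j L : ℕ) → positionSum j (suc L) ≡ j * L + L C 2
  positionSum-suc j zero = cong (_+ 0) (sym (*-zeroʳ j))
  positionSum-suc j (suc L) = begin
      j + positionSum (suc j) (suc L)
    ≡⟨ cong (j +_) (positionSum-suc (suc j) L) ⟩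
      j + (suc j * L + L C 2)
    ≡⟨ solve 3 (λ j L c → j :+ ((con 1 :+ j) :* L :+ c) := j :* (con 1 :+ L) :+ (L :+ c)) refl j L (L C 2) ⟩
      j * suc L + (L + L C 2)
    ≡⟨ cong (λ z → j * suc L + (z + L C 2)) (sym (nC1≡n L)) ⟩
      j * suc L + (L C 1 + L C 2)
    ≡⟨ cong (j * suc L +_) (nCk+nC[k+1]≡[n+1]C[k+1] L 1) ⟩
      j * suc L + suc L C 2
    ∎
    where
    open ≡-Reasoning
    open +-*-Solver

  positionSum-1 : (d : ℕ) → positionSum 1 d ≡ d C 2
  positionSum-1 zero = refl
  positionSum-1 (suc L) =
    trans (positionSum-suc 1 L)
          (trans (cong (_+ L C 2) (trans (*-identityˡ L) (sym (nC1≡n L)))) (nCk+nC[k+1]≡[n+1]C[k+1] L 1))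

  C2∸maj≡comaj-opposite : {d : ℕ} (σ : Fin d → Fin d) → (∀ i j → σ i ≡ σ j → i ≡ j) →
    (suc d C 2) ∸ maj σ ≡ d + comaj (flip _<ᵇ_) (toℕ ∘ σ ∘ opposite)
  C2∸maj≡comaj-opposite {d} σ inj = begin
      (suc d C 2) ∸ maj σ
    ≡⟨ cong₂ _∸_ (sym (nCk+nC[k+1]≡[n+1]C[k+1] d 1)) (majFrom≡majBy 1 ℓ) ⟩
      (d C 1 + d C 2) ∸ X
    ≡⟨ cong₂ (λ u v → (u + v) ∸ X) (nC1≡n d) (sym X+Y≡dC2) ⟩
      (d + (X + Y)) ∸ X
    ≡⟨ cong (_∸ X) (trans (cong (d +_) (+-comm X Y)) (sym (+-assoc d Y X))) ⟩
      (d + Y + X) ∸ X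
    ≡⟨ m+n∸n≡m (d + Y) X ⟩
      d + Y
    ≡⟨ cong (d +_) (sym comaj≡Y) ⟩
      d + comaj (flip _<ᵇ_) (toℕ ∘ σ ∘ opposite)
    ∎
    where
    open ≡-Reasoning
    ℓ = map (toℕ ∘ σ) (allFin d)
    X = majBy (flip _<ᵇ_) 1 ℓ
    Y = majBy _<ᵇ_ 1 ℓ
    X+Y≡dC2 : X + Y ≡ d C 2
    X+Y≡dC2 =
      trans (majBy-descents+ascents 1 ℓ (map-allFin-adjacentDistinct (toℕ ∘ σ) (λ i j e → inj i j (toℕ-injective e))))
            (trans (cong (positionSum 1) (length-map-allFin (toℕ ∘ σ))) (positionSum-1 d))
    comaj≡Y : comaj (flip _<ᵇ_) (toℕ ∘ σ ∘ opposite) ≡ Y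
    comaj≡Y = begin
        comaj (flip _<ᵇ_) (toℕ ∘ σ ∘ opposite)
      ≡⟨ comaj≡comajL (flip _<ᵇ_) (toℕ ∘ σ ∘ opposite) ⟩
        comajL (flip _<ᵇ_) (map (toℕ ∘ σ ∘ opposite) (allFin d))
      ≡⟨ cong (comajL (flip _<ᵇ_)) (map-opposite-allFin d (toℕ ∘ σ)) ⟩
        comajL (flip _<ᵇ_) (reverse ℓ)
      ≡⟨ sym (majBy-reverse _<ᵇ_ (reverse ℓ)) ⟩
        majBy _<ᵇ_ 1 (reverse (reverse ℓ))
      ≡⟨ cong (majBy _<ᵇ_ 1) (reverse-involutive ℓ) ⟩
        Y
      ∎

  injective⇒surjective : {d : ℕ} (h : Fin d → Fin d) → (∀ a b → h a ≡ h b → a ≡ b) → ∀ i → Σ (Fin d) (λ v → h v ≡ i)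
  injective⇒surjective {suc d} h inj i with any? (λ v → h v ≟ᶠ i)
  ... | yes (v , p) = v , p
  ... | no ¬hit with pigeonhole (n<1+n d) (λ v → punchOut {i = i} {j = h v} (λ e → ¬hit (v , sym e)))
  ...   | a , b , a<b , collide = ⊥-elim (<-irrefl (cong toℕ a≡b) a<b)
    where
    a≡b : a ≡ b
    a≡b = inj a b (punchOut-injective (λ e → ¬hit (a , sym e)) (λ e → ¬hit (b , sym e)) collide)

  StrictlyIncreasing : {d : ℕ} → (Fin d → Fin d) → Set
  StrictlyIncreasing h = ∀ i j → toℕ i < toℕ j → toℕ (h i) < toℕ (h j)

  strictlyIncreasing-≥ : {d : ℕ} (h : Fin d → Fin d) → StrictlyIncreasing h →
    ∀ k (i : Fin d) → toℕ i ≡ k → k ≤ toℕ (h i)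
  strictlyIncreasing-≥ h mono zero i e = z≤n
  strictlyIncreasing-≥ {d} h mono (suc k) i e =
    ≤-trans (s≤s (strictlyIncreasing-≥ h mono k i′ (toℕ-fromℕ< k<d)))
            (mono i′ i (subst (_< toℕ i) (sym (toℕ-fromℕ< k<d)) (subst (k <_) (sym e) (n<1+n k))))
    where
    k<d : k < d
    k<d = ≤-trans (n≤1+n (suc k)) (subst (_< d) e (toℕ<n i))
    i′ = fromℕ< k<d

  strictlyIncreasing-≤ : {d : ℕ} (h : Fin d → Fin d) → StrictlyIncreasing h →
    ∀ k (i : Fin d) → suc (toℕ i + k) ≡ d → suc (toℕ (h i) + k) ≤ d
  strictlyIncreasing-≤ {d} h mono zero i e = subst (_≤ d) (cong suc (sym (+-identityʳ _))) (toℕ<n (h i))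
  strictlyIncreasing-≤ {d} h mono (suc k) i e =
    ≤-trans (s≤s (≤-reflexive (+-suc (toℕ (h i)) k)))
            (≤-trans (s≤s (+-monoˡ-≤ k (mono i i″ (subst (toℕ i <_) (sym (toℕ-fromℕ< j<d)) (n<1+n (toℕ i))))))
                     (strictlyIncreasing-≤ h mono k i″
                        (trans (cong (λ z → suc (z + k)) (toℕ-fromℕ< j<d))
                            (trans (cong suc (sym (+-suc (toℕ i) k))) e))))
    where
    j<d : suc (toℕ i) < d
    j<d = subst (suc (suc (toℕ i)) ≤_) e (≤-trans (s≤s (s≤s (m≤m+n (toℕ i) k)))
        (s≤s (≤-reflexive (sym (+-suc (toℕ i) k)))))
    i″ = fromℕ< j<d

  strictlyIncreasing⇒id : {d : ℕ} (h : Fin d → Fin d) → StrictlyIncreasing h → ∀ i → h i ≡ i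
  strictlyIncreasing⇒id {d} h mono i = toℕ-injective (≤-antisym h≤i (strictlyIncreasing-≥ h mono (toℕ i) i refl))
    where
    k = d ∸ suc (toℕ i)
    e : suc (toℕ i + k) ≡ d
    e = m+[n∸m]≡n (toℕ<n i)
    h≤i : toℕ (h i) ≤ toℕ i
    h≤i = +-cancelʳ-≤ k (toℕ (h i)) (toℕ i)
            (≤-pred (subst (suc (toℕ (h i) + k) ≤_) (sym e) (strictlyIncreasing-≤ h mono k i e)))

  listing-injective : {d : ℕ} {y : Fin d → Fin d} → isListing y ≡ true → ∀ i j → y i ≡ y j → i ≡ j
  listing-injective e i j p = ==⇒≡ (⇒ᵇ-elim (∀ᵇ-elim (∀ᵇ-elim (∧-elimˡ e) i) j) (≡⇒== p))

  listing-surjective : {d : ℕ} {y : Fin d → Fin d} → isListing y ≡ true → ∀ v → Σ (Fin d) (λ i → y i ≡ v)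
  listing-surjective {y = y} e v
    with ∃ᵇ-elim {P = λ i → y i == v} (∀ᵇ-elim (∧-elimʳ {∀ᵇ (λ i → ∀ᵇ (λ j → (y i == y j) ⇒ᵇ (i == j)))} e) v)
  ... | i , p = i , ==⇒≡ p

  listing-inverse : {d : ℕ} {y : Fin d → Fin d} → isListing y ≡ true →
    Σ (Fin d → Fin d) (λ y⁻¹ → (∀ v → y (y⁻¹ v) ≡ v) × (∀ i → y⁻¹ (y i) ≡ i))
  listing-inverse {y = y} e = y⁻¹ , y∘y⁻¹ , λ i → listing-injective e _ i (y∘y⁻¹ (y i))
    where
    y⁻¹ = λ v → proj₁ (listing-surjective e v)
    y∘y⁻¹ = λ v → proj₂ (listing-surjective e v)

  linExt-respects-reach : {d : ℕ} {O : Orient d} {y : Fin d → Fin d} → isLinExt O y ≡ true →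
    ∀ i j → reach O (y i) (y j) ≡ true → ¬ y i ≡ y j → toℕ i < toℕ j
  linExt-respects-reach {y = y} e i j r ne =
    <ᵇ-true⇒< (⇒ᵇ-elim (∀ᵇ-elim (∀ᵇ-elim (∧-elimʳ {isListing y} e) i) j) (∧-intro r (not-intro (≢⇒==-false ne))))

  orientation-arc⇒edge : {d : ℕ} {adj : Adj d} {O : Orient d} → isOrientation adj O ≡ true →
    ∀ u w → O u w ≡ true → adj u w ≡ true
  orientation-arc⇒edge e u w = ⇒ᵇ-elim (∧-elimˡ (∀ᵇ-elim (∀ᵇ-elim e u) w))

  orientation-edge⇒xor : {d : ℕ} {adj : Adj d} {O : Orient d} → isOrientation adj O ≡ true →
    ∀ u w → adj u w ≡ true → (O u w xor O w u) ≡ true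
  orientation-edge⇒xor {adj = adj} {O} e u w = ⇒ᵇ-elim (∧-elimʳ {O u w ⇒ᵇ adj u w} (∀ᵇ-elim (∀ᵇ-elim e u) w))

  reachWithin-refl : {d : ℕ} (O : Orient d) → ∀ k u → reachWithin O k u u ≡ true
  reachWithin-refl O zero u = ≡⇒== refl
  reachWithin-refl O (suc k) u = ∨-introˡ (reachWithin-refl O k u)

  arc⇒reach : {d : ℕ} (O : Orient d) → ∀ u w → O u w ≡ true → reach O u w ≡ true
  arc⇒reach {suc d} O u w e = ∨-introʳ {reachWithin O d u w} (∃ᵇ-intro u (∧-intro (reachWithin-refl O d u) e))

  reachWithin⇒≡⊎ : {d : ℕ} (O : Orient d) (R : Fin d → Fin d → Set) → (∀ {u v w} → R u v → R v w → R u w) →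
    (∀ u w → O u w ≡ true → R u w) → ∀ k u w → reachWithin O k u w ≡ true → u ≡ w ⊎ R u w
  reachWithin⇒≡⊎ O R R-trans arc zero u w e = inj₁ (==⇒≡ e)
  reachWithin⇒≡⊎ O R R-trans arc (suc k) u w e with ∨-elim {reachWithin O k u w} e
  ... | inj₁ p = reachWithin⇒≡⊎ O R R-trans arc k u w p
  ... | inj₂ q with ∃ᵇ-elim q
  ...   | v , r with reachWithin⇒≡⊎ O R R-trans arc k u v (∧-elimˡ r)
  ...     | inj₁ refl = inj₂ (arc u w (∧-elimʳ {reachWithin O k u u} r))
  ...     | inj₂ Ruv = inj₂ (R-trans Ruv (arc v w (∧-elimʳ {reachWithin O k u v} r)))

  NaturalLabelling : {d : ℕ} → Adj d → (Orient d → Fin d → Fin d) → Set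
  NaturalLabelling {d} adj ω = ∀ O → isAcyclicOrientation adj O ≡ true →
    Bijective _≡_ _≡_ (ω O) × (∀ u w → ¬ u ≡ w → reach O u w ≡ true → toℕ (ω O u) < toℕ (ω O w))

  -- Stanley's (P, ω)-partition condition for the chain 0 < 1 < ⋯ < d - 1 labelled by σ, values ordered by ≺
  Compatible : (ℕ → ℕ → Set) → {d : ℕ} → (Fin d → Fin d) → (Fin d → ℕ) → Set
  Compatible _≺_ σ g = ∀ i j → toℕ j ≡ suc (toℕ i) → ¬ g j ≺ g i × (toℕ (σ i) < toℕ (σ j) → g i ≺ g j)

  module Decomposition {d : ℕ} (adj : Adj d)
    (adj-sym : ∀ u v → adj u v ≡ adj v u) (adj-irr : ∀ u → adj u u ≡ false)
    (ω : Orient d → Fin d → Fin d) (ω-natural : NaturalLabelling adj ω)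
    {_≺_ : ℕ → ℕ → Set} (≺-isStrictTotalOrder : IsStrictTotalOrder _≡_ _≺_)
    (F : Fin d → ℕ)
    where

    open IsStrictTotalOrder ≺-isStrictTotalOrder
      using () renaming (_<?_ to _≺?_; trans to ≺-trans; compare to ≺-compare; asym to ≺-asym; irrefl to ≺-irreflexive)

    ≺-irrefl : ∀ {a} → ¬ a ≺ a
    ≺-irrefl = ≺-irreflexive refl

    ≺⇒≢ : ∀ {a b} → a ≺ b → ¬ a ≡ b
    ≺⇒≢ p refl = ≺-irrefl p

    ⊀-trans : ∀ {a b c} → ¬ b ≺ a → ¬ c ≺ b → ¬ c ≺ a
    ⊀-trans {a} {b} nba ncb ca with ≺-compare a b
    ... | tri< ab _ _ = ncb (≺-trans ca ab)
    ... | tri≈ _ refl _ = ncb ca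
    ... | tri> _ _ ba = nba ba

    ⊀-antisym : ∀ {a b} → ¬ a ≺ b → ¬ b ≺ a → a ≡ b
    ⊀-antisym {a} {b} nab nba with ≺-compare a b
    ... | tri< ab _ _ = ⊥-elim (nab ab)
    ... | tri≈ _ a≡b _ = a≡b
    ... | tri> _ _ ba = ⊥-elim (nba ba)

    _≺ᵇ_ : ℕ → ℕ → Bool
    a ≺ᵇ b = ⌊ a ≺? b ⌋

    ≺ᵇ⇒≺ : ∀ {a b} → a ≺ᵇ b ≡ true → a ≺ b
    ≺ᵇ⇒≺ {a} {b} e with a ≺? b
    ... | yes p = p

    ≺⇒≺ᵇ : ∀ {a b} → a ≺ b → a ≺ᵇ b ≡ true
    ≺⇒≺ᵇ {a} {b} p with a ≺? b
    ... | yes _ = refl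
    ... | no np = ⊥-elim (np p)

    ⊀⇒≺ᵇ-false : ∀ {a b} → ¬ a ≺ b → a ≺ᵇ b ≡ false
    ⊀⇒≺ᵇ-false n = ¬true⇒false (λ e → n (≺ᵇ⇒≺ e))

    inducedOrient : Orient d
    inducedOrient u w = adj u w ∧ F u ≺ᵇ F w

    Proper : Set
    Proper = ∀ u w → adj u w ≡ true → ¬ F u ≡ F w

    CompatibleWith : Orient d → (Fin d → Fin d) → Set
    CompatibleWith O y = Compatible _≺_ (ω O ∘ y) (F ∘ y)

    compatible-chain : (O : Orient d) (y : Fin d → Fin d) → CompatibleWith O y →
      ∀ k (i j : Fin d) → toℕ j ≡ toℕ i + k →
      ¬ F (y j) ≺ F (y i) × (F (y i) ≡ F (y j) → toℕ (ω O (y j)) ≤ toℕ (ω O (y i)))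
    compatible-chain O y c zero i j e with toℕ-injective {i = j} {j = i} (trans e (+-identityʳ _))
    ... | refl = ≺-irrefl , (λ _ → ≤-refl)
    compatible-chain O y c (suc k) i j e = ⊀-trans (proj₁ ih) (proj₁ step) , labels-descend
      where
      i+k<d : toℕ i + k < d
      i+k<d = <⇒≤ (subst (λ z → suc z ≤ d) (trans e (+-suc (toℕ i) k)) (toℕ<n j))
      j′ = fromℕ< i+k<d
      ih = compatible-chain O y c k i j′ (toℕ-fromℕ< i+k<d)
      step = c j′ j (trans e (trans (+-suc (toℕ i) k) (cong suc (sym (toℕ-fromℕ< i+k<d)))))
      labels-descend : F (y i) ≡ F (y j) → toℕ (ω O (y j)) ≤ toℕ (ω O (y i))
      labels-descend Fij = ≤-trans (≮⇒≥ (λ p → ≺-irrefl (subst (_≺ F (y j)) (trans (sym Fij′) Fij) (proj₂ step p))))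
                                   (proj₂ ih Fij′)
        where
        Fij′ : F (y i) ≡ F (y j′)
        Fij′ = ⊀-antisym (λ p → proj₁ step (subst (_≺ F (y j′)) Fij p)) (proj₁ ih)

    module FromCompatible (O : Orient d) (acyclic : isAcyclicOrientation adj O ≡ true) (y : Fin d → Fin d)
                          (linExt : isLinExt O y ≡ true) (compatible : CompatibleWith O y) where

      arc⇒edge : ∀ u w → O u w ≡ true → adj u w ≡ true
      arc⇒edge = orientation-arc⇒edge {adj = adj} {O} (∧-elimˡ {isOrientation adj O} acyclic)

      edge⇒xor : ∀ u w → adj u w ≡ true → (O u w xor O w u) ≡ true
      edge⇒xor = orientation-edge⇒xor {adj = adj} {O} (∧-elimˡ {isOrientation adj O} acyclic)

      listed-arc-≺ : ∀ i j → O (y i) (y j) ≡ true → F (y i) ≺ F (y j)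
      listed-arc-≺ i j p = by-trichotomy (≺-compare (F (y i)) (F (y j)))
        where
        yi≢yj : ¬ y i ≡ y j
        yi≢yj q = true≢false (arc⇒edge (y i) (y j) p) (trans (cong (adj (y i)) (sym q)) (adj-irr (y i)))
        r = arc⇒reach O (y i) (y j) p
        chain = compatible-chain O y compatible (toℕ j ∸ toℕ i) i j
                  (sym (m+[n∸m]≡n (<⇒≤ (linExt-respects-reach linExt i j r yi≢yj))))
        by-trichotomy : Tri (F (y i) ≺ F (y j)) (F (y i) ≡ F (y j)) (F (y j) ≺ F (y i)) → F (y i) ≺ F (y j)
        by-trichotomy (tri< lt _ _) = lt
        by-trichotomy (tri≈ _ eq _) = ⊥-elim (<⇒≱ (proj₂ (ω-natural O acyclic) (y i) (y j) yi≢yj r) (proj₂ chain eq))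
        by-trichotomy (tri> _ _ gt) = ⊥-elim (proj₁ chain gt)

      arc-≺ : ∀ u w → O u w ≡ true → F u ≺ F w
      arc-≺ u w p with listing-surjective (∧-elimˡ linExt) u | listing-surjective (∧-elimˡ linExt) w
      ... | i , refl | j , refl = listed-arc-≺ i j p

      O≗inducedOrient : ∀ u w → O u w ≡ inducedOrient u w
      O≗inducedOrient u w = true⇔true⇒≡
        (λ p → ∧-intro (arc⇒edge u w p) (≺⇒≺ᵇ (arc-≺ u w p)))
        (λ p → by-direction (xor-elim (edge⇒xor u w (∧-elimˡ p))) (≺ᵇ⇒≺ (∧-elimʳ {adj u w} p)))
        where
        by-direction : (O u w ≡ true × O w u ≡ false) ⊎ (O u w ≡ false × O w u ≡ true) → F u ≺ F w → O u w ≡ true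
        by-direction (inj₁ (uw , _)) _ = uw
        by-direction (inj₂ (_ , wu)) lt = ⊥-elim (≺-asym lt (arc-≺ w u wu))

      proper : Proper
      proper u w a with xor-elim (edge⇒xor u w a)
      ... | inj₁ (uw , _) = ≺⇒≢ (arc-≺ u w uw)
      ... | inj₂ (_ , wu) = λ e → ≺⇒≢ (arc-≺ w u wu) (sym e)

    module FromProper (O : Orient d) (O≗inducedOrient : ∀ u w → O u w ≡ inducedOrient u w) (proper : Proper) where

      arc-≺ : ∀ u w → O u w ≡ true → F u ≺ F w
      arc-≺ u w p = ≺ᵇ⇒≺ (∧-elimʳ {adj u w} (trans (sym (O≗inducedOrient u w)) p))

      reach-≺ : ∀ u w → reach O u w ≡ true → u ≡ w ⊎ F u ≺ F w
      reach-≺ = reachWithin⇒≡⊎ O (λ u w → F u ≺ F w) ≺-trans arc-≺ d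

      arc-true : ∀ u w → adj u w ≡ true → F u ≺ F w → O u w ≡ true
      arc-true u w a lt = trans (O≗inducedOrient u w) (∧-intro a (≺⇒≺ᵇ lt))

      arc-false : ∀ u w → ¬ F u ≺ F w → O u w ≡ false
      arc-false u w n = trans (O≗inducedOrient u w) (trans (cong (adj u w ∧_) (⊀⇒≺ᵇ-false n)) (∧-zeroʳ (adj u w)))

      edge⇒xor : ∀ u w → adj u w ≡ true → (O u w xor O w u) ≡ true
      edge⇒xor u w a with ≺-compare (F u) (F w)
      ... | tri< lt _ _ = xor-introˡ (arc-true u w a lt) (arc-false w u (≺-asym lt))
      ... | tri≈ _ eq _ = ⊥-elim (proper u w a eq)
      ... | tri> _ _ gt = xor-introʳ (arc-false u w (≺-asym gt)) (arc-true w u (trans (adj-sym w u) a) gt)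

      acyclic : isAcyclicOrientation adj O ≡ true
      acyclic = ∧-intro (∀ᵇ-intro (λ u → ∀ᵇ-intro (λ w → ∧-intro (⇒ᵇ-intro (arc⇒edge u w)) (⇒ᵇ-intro (edge⇒xor u w)))))
                        (∀ᵇ-intro (λ u → ∀ᵇ-intro (λ v → ⇒ᵇ-intro (λ p → not-intro (¬true⇒false (no-return u v p))))))
        where
        arc⇒edge : ∀ u w → O u w ≡ true → adj u w ≡ true
        arc⇒edge u w p = ∧-elimˡ (trans (sym (O≗inducedOrient u w)) p)
        no-return : ∀ u v → O u v ≡ true → ¬ reach O v u ≡ true
        no-return u v p r with reach-≺ v u r
        ... | inj₁ refl = ≺-irrefl (arc-≺ u u p)
        ... | inj₂ vu = ≺-asym vu (arc-≺ u v p)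

      σ : Fin d → Fin d
      σ = ω O

      σ-injective : ∀ {a b} → σ a ≡ σ b → a ≡ b
      σ-injective = proj₁ (proj₁ (ω-natural O acyclic))

      -- ties in F are broken by decreasing label, as compatibility demands
      _◁_ : Fin d → Fin d → Set
      u ◁ w = F u ≺ F w ⊎ (F u ≡ F w × toℕ (σ w) < toℕ (σ u))

      _◁ᵇ_ : Fin d → Fin d → Bool
      u ◁ᵇ w = F u ≺ᵇ F w ∨ ((F u ≡ᵇ F w) ∧ (toℕ (σ w) <ᵇ toℕ (σ u)))

      ◁ᵇ⇒◁ : ∀ {u w} → u ◁ᵇ w ≡ true → u ◁ w
      ◁ᵇ⇒◁ {u} {w} e with ∨-elim {F u ≺ᵇ F w} e
      ... | inj₁ p = inj₁ (≺ᵇ⇒≺ p)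
      ... | inj₂ q = inj₂ (≡ᵇ-true⇒≡ (∧-elimˡ q) , <ᵇ-true⇒< (∧-elimʳ {F u ≡ᵇ F w} q))

      ◁⇒◁ᵇ : ∀ {u w} → u ◁ w → u ◁ᵇ w ≡ true
      ◁⇒◁ᵇ (inj₁ p) = ∨-introˡ (≺⇒≺ᵇ p)
      ◁⇒◁ᵇ {u} {w} (inj₂ (e , p)) = ∨-introʳ {F u ≺ᵇ F w} (∧-intro (≡⇒≡ᵇ-true e) (<⇒<ᵇ-true p))

      ◁-irrefl : ∀ {u} → ¬ u ◁ u
      ◁-irrefl (inj₁ p) = ≺-irrefl p
      ◁-irrefl (inj₂ (_ , p)) = <-irrefl refl p

      ◁-trans : ∀ {a b c} → a ◁ b → b ◁ c → a ◁ c
      ◁-trans (inj₁ p) (inj₁ q) = inj₁ (≺-trans p q)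
      ◁-trans {a} (inj₁ p) (inj₂ (e , _)) = inj₁ (subst (F a ≺_) e p)
      ◁-trans {c = c} (inj₂ (e , _)) (inj₁ q) = inj₁ (subst (_≺ F c) (sym e) q)
      ◁-trans (inj₂ (e , p)) (inj₂ (e′ , q)) = inj₂ (trans e e′ , <-trans q p)

      ◁-total : ∀ u w → ¬ u ≡ w → u ◁ w ⊎ w ◁ u
      ◁-total u w u≢w with ≺-compare (F u) (F w)
      ... | tri< lt _ _ = inj₁ (inj₁ lt)
      ... | tri> _ _ gt = inj₂ (inj₁ gt)
      ... | tri≈ _ eq _ with <-cmp (toℕ (σ w)) (toℕ (σ u))
      ...   | tri< lt _ _ = inj₁ (inj₂ (eq , lt))
      ...   | tri≈ _ eq′ _ = ⊥-elim (u≢w (σ-injective (toℕ-injective (sym eq′))))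
      ...   | tri> _ _ gt = inj₂ (inj₂ (sym eq , gt))

      rank : Fin d → ℕ
      rank v = ∑ (λ u → ⟦ u ◁ᵇ v ⟧) (allFin d)

      ⟦◁ᵇ-refl⟧ : ∀ v → ⟦ v ◁ᵇ v ⟧ ≡ 0
      ⟦◁ᵇ-refl⟧ v = cong ⟦_⟧ (¬true⇒false (λ p → ◁-irrefl (◁ᵇ⇒◁ p)))

      rank-mono : ∀ {u w} → u ◁ w → rank u < rank w
      rank-mono {u} {w} uw =
        ∑-allFin-mono-< (λ x → ⟦⟧-mono (λ p → ◁⇒◁ᵇ (◁-trans (◁ᵇ⇒◁ p) uw))) u
                        (subst₂ _<_ (sym (⟦◁ᵇ-refl⟧ u)) (sym (cong ⟦_⟧ (◁⇒◁ᵇ uw))) (s≤s z≤n))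

      rank<d : ∀ v → rank v < d
      rank<d v = subst (rank v <_) (∑-allFin-1 d)
        (∑-allFin-mono-< (λ x → ⟦⟧-mono {x ◁ᵇ v} {true} (λ _ → refl)) v (subst (_< 1) (sym (⟦◁ᵇ-refl⟧ v)) (s≤s z≤n)))

      rankᶠ : Fin d → Fin d
      rankᶠ v = fromℕ< (rank<d v)

      toℕ-rankᶠ : ∀ v → toℕ (rankᶠ v) ≡ rank v
      toℕ-rankᶠ v = toℕ-fromℕ< (rank<d v)

      rankᶠ-injective : ∀ u w → rankᶠ u ≡ rankᶠ w → u ≡ w
      rankᶠ-injective u w e with u ≟ᶠ w
      ... | yes u≡w = u≡w
      ... | no u≢w with ◁-total u w u≢w
      ...   | inj₁ uw = ⊥-elim (<-irrefl (trans (sym (toℕ-rankᶠ u)) (trans (cong toℕ e) (toℕ-rankᶠ w))) (rank-mono uw))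
      ...   | inj₂ wu = ⊥-elim (<-irrefl (trans (sym (toℕ-rankᶠ w)) (trans (cong toℕ (sym e)) (toℕ-rankᶠ u)))
          (rank-mono wu))

      sorted : Fin d → Fin d
      sorted i = proj₁ (injective⇒surjective rankᶠ rankᶠ-injective i)

      rankᶠ∘sorted : ∀ i → rankᶠ (sorted i) ≡ i
      rankᶠ∘sorted i = proj₂ (injective⇒surjective rankᶠ rankᶠ-injective i)

      sorted-injective : ∀ i j → sorted i ≡ sorted j → i ≡ j
      sorted-injective i j e = trans (sym (rankᶠ∘sorted i)) (trans (cong rankᶠ e) (rankᶠ∘sorted j))

      sorted∘rankᶠ : ∀ v → sorted (rankᶠ v) ≡ v
      sorted∘rankᶠ v = rankᶠ-injective _ _ (rankᶠ∘sorted (rankᶠ v))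

      sorted-◁ : ∀ i j → toℕ i < toℕ j → sorted i ◁ sorted j
      sorted-◁ i j i<j with ◁-total (sorted i) (sorted j) (λ e → <-irrefl (cong toℕ (sorted-injective i j e)) i<j)
      ... | inj₁ ij = ij
      ... | inj₂ ji = ⊥-elim (<-asym i<j (subst₂ _<_ (rank-sorted j) (rank-sorted i) (rank-mono ji)))
        where
        rank-sorted : ∀ i → rank (sorted i) ≡ toℕ i
        rank-sorted i = trans (sym (toℕ-rankᶠ (sorted i))) (cong toℕ (rankᶠ∘sorted i))

      module _ (z : Fin d → Fin d) (z≗sorted : ∀ i → z i ≡ sorted i) where

        private
          z-injective : ∀ i j → z i ≡ z j → i ≡ j
          z-injective i j e = sorted-injective i j (trans (sym (z≗sorted i)) (trans e (z≗sorted j)))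

          z-◁ : ∀ i j → toℕ i < toℕ j → z i ◁ z j
          z-◁ i j i<j = subst₂ _◁_ (sym (z≗sorted i)) (sym (z≗sorted j)) (sorted-◁ i j i<j)

        sorted-listing : isListing z ≡ true
        sorted-listing =
          ∧-intro (∀ᵇ-intro (λ i → ∀ᵇ-intro (λ j → ⇒ᵇ-intro (λ p → ≡⇒== (z-injective i j (==⇒≡ p))))))
                  (∀ᵇ-intro (λ v → ∃ᵇ-intro (rankᶠ v) (≡⇒== (trans (z≗sorted (rankᶠ v)) (sorted∘rankᶠ v)))))

        sorted-linExt : isLinExt O z ≡ true
        sorted-linExt = ∧-intro sorted-listing (∀ᵇ-intro (λ i → ∀ᵇ-intro (λ j → ⇒ᵇ-intro (λ p →
          <⇒<ᵇ-true (reach⇒< i j (∧-elimˡ p) (λ e → true≢false (≡⇒== e)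
              (not-elim (∧-elimʳ {reach O (z i) (z j)} p))))))))
          where
          reach⇒< : ∀ i j → reach O (z i) (z j) ≡ true → ¬ z i ≡ z j → toℕ i < toℕ j
          reach⇒< i j r zi≢zj with reach-≺ (z i) (z j) r
          ... | inj₁ e = ⊥-elim (zi≢zj e)
          ... | inj₂ lt with <-cmp (toℕ i) (toℕ j)
          ...   | tri< i<j _ _ = i<j
          ...   | tri≈ _ i≡j _ = ⊥-elim (zi≢zj (cong z (toℕ-injective i≡j)))
          ...   | tri> _ _ j<i with z-◁ j i j<i
          ...     | inj₁ gt = ⊥-elim (≺-asym lt gt)
          ...     | inj₂ (eq , _) = ⊥-elim (≺⇒≢ lt (sym eq))

        sorted-compatible : CompatibleWith O z
        sorted-compatible i j e = weak , strict
          where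
          zi◁zj = z-◁ i j (subst (toℕ i <_) (sym e) (n<1+n (toℕ i)))
          weak : ¬ F (z j) ≺ F (z i)
          weak lt with zi◁zj
          ... | inj₁ gt = ≺-asym lt gt
          ... | inj₂ (eq , _) = ≺⇒≢ lt (sym eq)
          strict : toℕ (σ (z i)) < toℕ (σ (z j)) → F (z i) ≺ F (z j)
          strict lt with zi◁zj
          ... | inj₁ gt = gt
          ... | inj₂ (_ , gt) = ⊥-elim (<-asym lt gt)

      compatible⇒sorted : ∀ y → isLinExt O y ≡ true → CompatibleWith O y → ∀ i → y i ≡ sorted i
      compatible⇒sorted y linExt compatible i =
        rankᶠ-injective (y i) (sorted i) (trans (strictlyIncreasing⇒id (rankᶠ ∘ y) rank-y-mono i)
            (sym (rankᶠ∘sorted i)))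
        where
        y-◁ : ∀ i j → toℕ i < toℕ j → y i ◁ y j
        y-◁ i j i<j with compatible-chain O y compatible (toℕ j ∸ toℕ i) i j (sym (m+[n∸m]≡n (<⇒≤ i<j)))
        ... | weak , labels with ≺-compare (F (y i)) (F (y j))
        ...   | tri< lt _ _ = inj₁ lt
        ...   | tri> _ _ gt = ⊥-elim (weak gt)
        ...   | tri≈ _ eq _ = inj₂ (eq , ≤∧≢⇒< (labels eq)
            (λ q → <-irrefl (cong toℕ (y-injective (σ-injective (toℕ-injective (sym q))))) i<j))
          where
          y-injective = listing-injective (∧-elimˡ linExt) i j
        rank-y-mono : StrictlyIncreasing (rankᶠ ∘ y)
        rank-y-mono i j i<j = subst₂ _<_ (sym (toℕ-rankᶠ (y i))) (sym (toℕ-rankᶠ (y j))) (rank-mono (y-◁ i j i<j))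

    isProper : Bool
    isProper = ∀ᵇ (λ u → ∀ᵇ (λ w → adj u w ⇒ᵇ not (F u ≡ᵇ F w)))

    isProper⇒Proper : isProper ≡ true → Proper
    isProper⇒Proper e u w a eq = true≢false (≡⇒≡ᵇ-true eq) (not-elim (⇒ᵇ-elim (∀ᵇ-elim (∀ᵇ-elim e u) w) a))

    Proper⇒isProper : Proper → isProper ≡ true
    Proper⇒isProper p =
      ∀ᵇ-intro (λ u → ∀ᵇ-intro (λ w → ⇒ᵇ-intro (λ a → not-intro (¬true⇒false (λ e → p u w a (≡ᵇ-true⇒≡ e))))))

    module Counting (compatibleᵇ : Orient d → (Fin d → Fin d) → Bool)
      (compatibleᵇ⇒ : ∀ O y → compatibleᵇ O y ≡ true → CompatibleWith O y)
      (⇒compatibleᵇ : ∀ O y → CompatibleWith O y → compatibleᵇ O y ≡ true) where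

      compatibleExtensions : Orient d → ℕ
      compatibleExtensions O =
        ⟦ isAcyclicOrientation adj O ⟧ * ∑ (λ y → ⟦ isLinExt O y ⟧ * ⟦ compatibleᵇ O y ⟧) (allFuns (allFin d) d)

      compatibleExtensions-none : ∀ O →
        (∀ y → isAcyclicOrientation adj O ≡ true → isLinExt O y ≡ true → compatibleᵇ O y ≡ true → ⊥) →
        compatibleExtensions O ≡ 0
      compatibleExtensions-none O none with isAcyclicOrientation adj O
      ... | false = refl
      ... | true = trans (+-identityʳ _) (∑-zero _ no-y (allFuns (allFin d) d))
        where
        no-y : ∀ y → ⟦ isLinExt O y ⟧ * ⟦ compatibleᵇ O y ⟧ ≡ 0
        no-y y with isLinExt O y in linExt | compatibleᵇ O y in compatible
        ... | true | true = ⊥-elim (none y refl linExt compatible)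
        ... | true | false = refl
        ... | false | _ = refl

      compatibleExtensions≡⟦sameOrient⟧ : Proper → ∀ O → compatibleExtensions O ≡ ⟦ sameOrient O inducedOrient ⟧
      compatibleExtensions≡⟦sameOrient⟧ proper O with sameOrient O inducedOrient in same
      ... | false = compatibleExtensions-none O (λ y a l c →
                      true≢false (≗⇒sameOrient (FromCompatible.O≗inducedOrient O a y l (compatibleᵇ⇒ O y c))) same)
      ... | true = begin
          ⟦ isAcyclicOrientation adj O ⟧ * ∑ (λ y → ⟦ isLinExt O y ⟧ * ⟦ compatibleᵇ O y ⟧) Ys
        ≡⟨ cong (λ b → ⟦ b ⟧ * ∑ (λ y → ⟦ isLinExt O y ⟧ * ⟦ compatibleᵇ O y ⟧) Ys) acyclic ⟩
          ∑ (λ y → ⟦ isLinExt O y ⟧ * ⟦ compatibleᵇ O y ⟧) Ys + 0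
        ≡⟨ +-identityʳ _ ⟩
          ∑ (λ y → ⟦ isLinExt O y ⟧ * ⟦ compatibleᵇ O y ⟧) Ys
        ≡⟨ ∑-cong only-sorted Ys ⟩
          ∑ (λ y → ⟦ sameFun y sorted ⟧) Ys
        ≡⟨ ∑-allFuns-indicator d d sorted ⟩
          1
        ∎
        where
        open ≡-Reasoning
        O≗ = sameOrient⇒≗ same
        open FromProper O O≗ proper using (acyclic; sorted; compatible⇒sorted; sorted-linExt; sorted-compatible)
        Ys = allFuns (allFin d) d
        only-sorted : ∀ y → ⟦ isLinExt O y ⟧ * ⟦ compatibleᵇ O y ⟧ ≡ ⟦ sameFun y sorted ⟧
        only-sorted y = trans (sym (⟦∧⟧ (isLinExt O y) (compatibleᵇ O y))) (cong ⟦_⟧ (true⇔true⇒≡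
          (λ p → ≗⇒sameFun (compatible⇒sorted y (∧-elimˡ p) (compatibleᵇ⇒ O y (∧-elimʳ {isLinExt O y} p))))
          (λ p → ∧-intro (sorted-linExt y (sameFun⇒≗ p)) (⇒compatibleᵇ O y (sorted-compatible y (sameFun⇒≗ p))))))

      ∑-compatibleExtensions≡⟦isProper⟧ : ∑ compatibleExtensions (allOrientCandidates d) ≡ ⟦ isProper ⟧
      ∑-compatibleExtensions≡⟦isProper⟧ with isProper in proper
      ... | true = trans (∑-cong (compatibleExtensions≡⟦sameOrient⟧ (isProper⇒Proper proper)) (allOrientCandidates d))
                         (∑-orientCandidates-indicator d inducedOrient)
      ... | false = ∑-zero compatibleExtensions (λ O → compatibleExtensions-none O (λ y a l c →
                      true≢false (Proper⇒isProper (FromCompatible.proper O a y l (compatibleᵇ⇒ O y c))) proper))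
                      (allOrientCandidates d)

  ∑-pairs : {d : ℕ} (adj : Adj d) (ψ : Orient d × (Fin d → Fin d) → ℕ) →
    ∑ ψ (pairs adj)
    ≡ ∑ (λ O → ⟦ isAcyclicOrientation adj O ⟧ * ∑ (λ y → ⟦ isLinExt O y ⟧ * ψ (O , y)) (allFuns (allFin d) d))
                        (allOrientCandidates d)
  ∑-pairs {d} adj ψ =
    trans (∑-concatMap ψ _ (filter (λ O → T? (isAcyclicOrientation adj O)) (allOrientCandidates d)))
    (trans (∑-filter _ (isAcyclicOrientation adj) (allOrientCandidates d))
    (∑-cong (λ O → cong (⟦ isAcyclicOrientation adj O ⟧ *_)
       (trans (∑-map ψ (O ,_) (filter (λ y → T? (isLinExt O y)) (allFuns (allFin d) d)))
              (∑-filter (λ y → ψ (O , y)) (isLinExt O) (allFuns (allFin d) d)))) (allOrientCandidates d)))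

  ∑-*-comm₃ : {A B C : Set} (as : List A) (bs : List B) (cs : List C)
    (a : A → ℕ) (b : B → ℕ) (c : B → C → ℕ) (e : A → B → C → ℕ) →
    ∑ (λ x → a x * ∑ (λ y → b y * ∑ (λ z → c y z * e x y z) cs) bs) as
    ≡ ∑ (λ y → b y * ∑ (λ z → c y z * ∑ (λ x → a x * e x y z) as) cs) bs
  ∑-*-comm₃ as bs cs a b c e =
    trans (∑-cong (λ x → sym (∑-*ˡ (a x) _ bs)) as)
    (trans (∑-comm (λ x y → a x * (b y * ∑ (λ z → c y z * e x y z) cs)) as bs)
    (∑-cong (λ y → trans (∑-cong (λ x → *-swap (a x) (b y) _) as)
                         (trans (∑-*ˡ (b y) _ as) (cong (b y *_) (inner y)))) bs))
    where
    *-swap : ∀ p q r → p * (q * r) ≡ q * (p * r)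
    *-swap p q r = trans (sym (*-assoc p q r)) (trans (cong (_* r) (*-comm p q)) (*-assoc q p r))
    inner : ∀ y → ∑ (λ x → a x * ∑ (λ z → c y z * e x y z) cs) as ≡ ∑ (λ z → c y z * ∑ (λ x → a x * e x y z) as) cs
    inner y =
      trans (∑-cong (λ x → sym (∑-*ˡ (a x) _ cs)) as)
      (trans (∑-comm (λ x z → a x * (c y z * e x y z)) as cs)
      (∑-cong (λ z → trans (∑-cong (λ x → *-swap (a x) (c y z) _) as) (∑-*ˡ (c y z) _ as)) cs))

  module Expansion {d : ℕ} (adj : Adj d)
    (adj-sym : ∀ u v → adj u v ≡ adj v u) (adj-irr : ∀ u → adj u u ≡ false)
    (ω : Orient d → Fin d → Fin d) (ω-natural : NaturalLabelling adj ω)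
    {_≺_ : ℕ → ℕ → Set} (≺-isStrictTotalOrder : IsStrictTotalOrder _≡_ _≺_)
    (compatibleᵇ : ∀ {N} → (Fin d → Fin N) → Orient d → (Fin d → Fin d) → Bool)
    (compatibleᵇ⇒ : ∀ {N} (f : Fin d → Fin N) O y → compatibleᵇ f O y ≡ true → Compatible _≺_ (ω O ∘ y) (toℕ ∘ f ∘ y))
    (⇒compatibleᵇ : ∀ {N} (f : Fin d → Fin N) O y → Compatible _≺_ (ω O ∘ y) (toℕ ∘ f ∘ y) → compatibleᵇ f O y ≡ true)
    (exponent : Orient d → (Fin d → Fin d) → ℕ)
    (count-compatible : ∀ N O y → isAcyclicOrientation adj O ≡ true → isLinExt O y ≡ true →
         countWithTotal d N (λ f → compatibleᵇ f O y) ≡ shiftedInvDen d (exponent O y) N)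
    where

    module OfPartition {N} (f : Fin d → Fin N) =
      Decomposition adj adj-sym adj-irr ω ω-natural ≺-isStrictTotalOrder (toℕ ∘ f)

    module CountOf {N} (f : Fin d → Fin N) =
      OfPartition.Counting f (compatibleᵇ f) (compatibleᵇ⇒ f) (⇒compatibleᵇ f)

    pG≡numerator⊛invDen : ∀ N →
      pG adj N ≡ (fromExponents (map (λ p → exponent (proj₁ p) (proj₂ p)) (pairs adj)) ⊛ invDen d) N
    pG≡numerator⊛invDen N = begin
        pG adj N
      ≡⟨ length-filter≡∑ (isGPartition adj N) Fs ⟩
        ∑ (λ f → ⟦ isGPartition adj N f ⟧) Fs
      ≡⟨ ∑-cong (λ f → trans (cong (λ s → ⟦ (s ≡ᵇ N) ∧ OfPartition.isProper f ⟧) (sum-map≡∑ (partOf f) (allFin d)))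
                             (⟦∧⟧ (total f ≡ᵇ N) (OfPartition.isProper f))) Fs ⟩
        ∑ (λ f → ⟦ total f ≡ᵇ N ⟧ * ⟦ OfPartition.isProper f ⟧) Fs
      ≡⟨ ∑-cong (λ f → cong (⟦ total f ≡ᵇ N ⟧ *_) (sym (CountOf.∑-compatibleExtensions≡⟦isProper⟧ f))) Fs ⟩
        ∑ (λ f → ⟦ total f ≡ᵇ N ⟧ * ∑ (CountOf.compatibleExtensions f) OCs) Fs
      ≡⟨ ∑-*-comm₃ Fs OCs Ys (λ f → ⟦ total f ≡ᵇ N ⟧) (λ O → ⟦ isAcyclicOrientation adj O ⟧)
                   (λ O y → ⟦ isLinExt O y ⟧) (λ f O y → ⟦ compatibleᵇ f O y ⟧) ⟩
        ∑ (λ O → ⟦ isAcyclicOrientation adj O ⟧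
                 * ∑ (λ y → ⟦ isLinExt O y ⟧ * countWithTotal d N (λ f → compatibleᵇ f O y)) Ys) OCs
      ≡⟨ ∑-cong (λ O → ⟦⟧*-cong (isAcyclicOrientation adj O) (λ a →
                         ∑-cong (λ y → ⟦⟧*-cong (isLinExt O y) (count-compatible N O y a)) Ys)) OCs ⟩
        ∑ (λ O → ⟦ isAcyclicOrientation adj O ⟧ * ∑ (λ y → ⟦ isLinExt O y ⟧ * shiftedInvDen d (exponent O y) N) Ys) OCs
      ≡⟨ sym (∑-pairs adj (λ p → shiftedInvDen d (exponent (proj₁ p) (proj₂ p)) N)) ⟩
        ∑ (λ p → shiftedInvDen d (exponent (proj₁ p) (proj₂ p)) N) (pairs adj)
      ≡⟨ sym (fromExponents-⊛ (λ p → exponent (proj₁ p) (proj₂ p)) (pairs adj) (invDen d) N) ⟩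
        (fromExponents (map (λ p → exponent (proj₁ p) (proj₂ p)) (pairs adj)) ⊛ invDen d) N
      ∎
      where
      open ≡-Reasoning
      Fs = allFuns (allFin N) d
      Ys = allFuns (allFin d) d
      OCs = allOrientCandidates d

  countRisingAlong≡shiftedInvDen : (cmp : ℕ → ℕ → Bool) {d : ℕ} (N : ℕ)
    (z z⁻¹ : Fin d → Fin d) (z∘z⁻¹ : ∀ v → z (z⁻¹ v) ≡ v) (z⁻¹∘z : ∀ i → z⁻¹ (z i) ≡ i) (τ : Fin d → ℕ) →
    countWithTotal d N (λ f → isRising cmp 0 τ (toℕ ∘ f ∘ z))
    ≡ shiftedInvDen d (d + comaj cmp τ) N
  countRisingAlong≡shiftedInvDen cmp {d} N z z⁻¹ z∘z⁻¹ z⁻¹∘z τ = begin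
      ∑ (λ f → ⟦ total f ≡ᵇ N ⟧ * ⟦ isRising cmp 0 τ (toℕ ∘ f ∘ z) ⟧) Fs
    ≡⟨ ∑-cong summand Fs ⟩
      ∑ (λ f → ⟦ Q (f ∘ z) ⟧) Fs
    ≡⟨ ∑-allFuns-reindex z z⁻¹ z∘z⁻¹ z⁻¹∘z N Q Q-ext ⟩
      countRising cmp N d 0 τ N
    ≡⟨ countRising≡shiftedInvDen cmp N d 0 τ N ≤-refl ⟩
      shiftedInvDen d (d + d * 0 + comaj cmp τ) N
    ≡⟨ cong (λ e → shiftedInvDen d (e + comaj cmp τ) N) (trans (cong (d +_) (*-zeroʳ d)) (+-identityʳ d)) ⟩
      shiftedInvDen d (d + comaj cmp τ) N
    ∎
    where
    open ≡-Reasoning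
    Fs = allFuns (allFin N) d
    Q : (Fin d → Fin N) → Bool
    Q g = isRising cmp 0 τ (toℕ ∘ g) ∧ (total g ≡ᵇ N)
    Q-ext : ∀ g g′ → (∀ i → g i ≡ g′ i) → Q g ≡ Q g′
    Q-ext g g′ e = cong₂ _∧_ (isRising-cong cmp 0 τ (toℕ ∘ g) (toℕ ∘ g′) (λ i → cong toℕ (e i)))
                             (cong (_≡ᵇ N) (∑-cong (λ i → cong (suc ∘ toℕ) (e i)) (allFin d)))
    summand : ∀ f → ⟦ total f ≡ᵇ N ⟧ * ⟦ isRising cmp 0 τ (toℕ ∘ f ∘ z) ⟧ ≡ ⟦ Q (f ∘ z) ⟧
    summand f =
      trans (*-comm ⟦ total f ≡ᵇ N ⟧ _)
      (trans (sym (⟦∧⟧ (isRising cmp 0 τ (toℕ ∘ f ∘ z)) _))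
             (cong (λ s → ⟦ isRising cmp 0 τ (toℕ ∘ f ∘ z) ∧ (s ≡ᵇ N) ⟧)
                 (sym (∑-allFin-reindex z z⁻¹ z∘z⁻¹ z⁻¹∘z (partOf f)))))

  step⇒ : {a b : ℕ} (c : Bool) → a + ⟦ c ⟧ ≤ b → ¬ b < a × (c ≡ true → a < b)
  step⇒ {a} {b} false le = (λ b<a → <⇒≱ b<a (subst (_≤ b) (+-identityʳ a) le)) , λ ()
  step⇒ {a} {b} true le = (λ b<a → <⇒≱ b<a (≤-trans (n≤1+n a) a<b)) , (λ _ → a<b)
    where
    a<b = subst (_≤ b) (+-comm a 1) le

  ⇒step : {a b : ℕ} (c : Bool) → ¬ b < a → (c ≡ true → a < b) → a + ⟦ c ⟧ ≤ b
  ⇒step {a} {b} false b≮a _ = subst (_≤ b) (sym (+-identityʳ a)) (≮⇒≥ b≮a)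
  ⇒step {a} {b} true _ a<b = subst (_≤ b) (+-comm 1 a) (a<b refl)

  Rises⇒Compatible : {d : ℕ} (σ : Fin d → Fin d) (g : Fin d → ℕ) → Rises _<ᵇ_ (toℕ ∘ σ) g → Compatible _<_ σ g
  Rises⇒Compatible σ g r i j e = proj₁ s , (λ lt → proj₂ s (<⇒<ᵇ-true lt))
    where
    s = step⇒ (toℕ (σ i) <ᵇ toℕ (σ j)) (r i j e)

  Compatible⇒Rises : {d : ℕ} (σ : Fin d → Fin d) (g : Fin d → ℕ) → Compatible _<_ σ g → Rises _<ᵇ_ (toℕ ∘ σ) g
  Compatible⇒Rises σ g c i j e = ⇒step _ (proj₁ (c i j e)) (λ t → proj₂ (c i j e) (<ᵇ-true⇒< t))

  opposite-consecutive : {d : ℕ} (i j : Fin d) → toℕ j ≡ suc (toℕ i) → toℕ (opposite i) ≡ suc (toℕ (opposite j))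
  opposite-consecutive {d} i j e =
    trans (opposite-prop i) (trans (cong (d ∸_) (sym e))
        (trans (∸-suc d (toℕ j) (toℕ<n j)) (cong suc (sym (opposite-prop j)))))
    where
    ∸-suc : ∀ m n → n < m → m ∸ n ≡ suc (m ∸ suc n)
    ∸-suc (suc m) zero _ = refl
    ∸-suc (suc m) (suc n) (s≤s n<m) = ∸-suc m n n<m

  -- Read backwards, a chain weakly decreasing in g (strictly at label ascents) rises strictly at label descents.
  Rises-opposite⇒Compatible : {d : ℕ} (σ : Fin d → Fin d) (g : Fin d → ℕ) →
    Rises (flip _<ᵇ_) (toℕ ∘ σ ∘ opposite) (g ∘ opposite) → Compatible (flip _<_) σ g
  Rises-opposite⇒Compatible σ g r i j e = proj₁ s , (λ lt → proj₂ s (<⇒<ᵇ-true lt))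
    where
    P : _ → _ → Set
    P a b = g a + ⟦ toℕ (σ b) <ᵇ toℕ (σ a) ⟧ ≤ g b
    s = step⇒ (toℕ (σ i) <ᵇ toℕ (σ j))
              (subst₂ P (opposite-involutive j) (opposite-involutive i)
                  (r (opposite j) (opposite i) (opposite-consecutive i j e)))

  Compatible⇒Rises-opposite : {d : ℕ} (σ : Fin d → Fin d) (g : Fin d → ℕ) →
    Compatible (flip _<_) σ g → Rises (flip _<ᵇ_) (toℕ ∘ σ ∘ opposite) (g ∘ opposite)
  Compatible⇒Rises-opposite σ g c i j e = ⇒step _ (proj₁ c′) (λ t → proj₂ c′ (<ᵇ-true⇒< t))
    where
    c′ = c (opposite j) (opposite i) (opposite-consecutive i j e)

  module FirstFormula {d : ℕ} (adj : Adj d)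
    (adj-sym : ∀ u v → adj u v ≡ adj v u) (adj-irr : ∀ u → adj u u ≡ false)
    (ω : Orient d → Fin d → Fin d) (ω-natural : NaturalLabelling adj ω) where

    compatibleᵇ : ∀ {N} → (Fin d → Fin N) → Orient d → (Fin d → Fin d) → Bool
    compatibleᵇ f O y = isRising _<ᵇ_ 0 (toℕ ∘ ω O ∘ y) (toℕ ∘ f ∘ y)

    compatibleᵇ⇒ : ∀ {N} (f : Fin d → Fin N) O y → compatibleᵇ f O y ≡ true → Compatible _<_ (ω O ∘ y) (toℕ ∘ f ∘ y)
    compatibleᵇ⇒ f O y e = Rises⇒Compatible (ω O ∘ y) (toℕ ∘ f ∘ y) (isRising⇒Rises _<ᵇ_ 0 _ _ e)

    ⇒compatibleᵇ : ∀ {N} (f : Fin d → Fin N) O y → Compatible _<_ (ω O ∘ y) (toℕ ∘ f ∘ y) → compatibleᵇ f O y ≡ true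
    ⇒compatibleᵇ f O y c = Rises⇒isRising _<ᵇ_ 0 _ _ (λ _ _ → z≤n) (Compatible⇒Rises (ω O ∘ y) (toℕ ∘ f ∘ y) c)

    exponent : Orient d → (Fin d → Fin d) → ℕ
    exponent O y = d + maj (op (ω O ∘ y))

    count-compatible : ∀ N O y → isAcyclicOrientation adj O ≡ true → isLinExt O y ≡ true →
      countWithTotal d N (λ f → compatibleᵇ f O y) ≡ shiftedInvDen d (exponent O y) N
    count-compatible N O y _ linExt with listing-inverse (∧-elimˡ linExt)
    ... | y⁻¹ , y∘y⁻¹ , y⁻¹∘y =
      trans (countRisingAlong≡shiftedInvDen _<ᵇ_ N y y⁻¹ y∘y⁻¹ y⁻¹∘y (toℕ ∘ ω O ∘ y))
            (cong (λ e → shiftedInvDen d (d + e) N) (sym (maj-op≡comaj (ω O ∘ y))))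

    open Expansion adj adj-sym adj-irr ω ω-natural <-isStrictTotalOrder
                   compatibleᵇ compatibleᵇ⇒ ⇒compatibleᵇ exponent count-compatible public

  module SecondFormula {d : ℕ} (adj : Adj d)
    (adj-sym : ∀ u v → adj u v ≡ adj v u) (adj-irr : ∀ u → adj u u ≡ false)
    (ω : Orient d → Fin d → Fin d) (ω-natural : NaturalLabelling adj ω) where

    compatibleᵇ : ∀ {N} → (Fin d → Fin N) → Orient d → (Fin d → Fin d) → Bool
    compatibleᵇ f O y = isRising (flip _<ᵇ_) 0 (toℕ ∘ ω O ∘ y ∘ opposite) (toℕ ∘ f ∘ y ∘ opposite)

    compatibleᵇ⇒ : ∀ {N} (f : Fin d → Fin N) O y → compatibleᵇ f O y ≡ true → Compatible (flip _<_) (ω O ∘ y)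
        (toℕ ∘ f ∘ y)
    compatibleᵇ⇒ f O y e = Rises-opposite⇒Compatible (ω O ∘ y) (toℕ ∘ f ∘ y) (isRising⇒Rises (flip _<ᵇ_) 0 _ _ e)

    ⇒compatibleᵇ : ∀ {N} (f : Fin d → Fin N) O y → Compatible (flip _<_) (ω O ∘ y) (toℕ ∘ f ∘ y) → compatibleᵇ
        f O y ≡ true
    ⇒compatibleᵇ f O y c =
      Rises⇒isRising (flip _<ᵇ_) 0 _ _ (λ _ _ → z≤n) (Compatible⇒Rises-opposite (ω O ∘ y) (toℕ ∘ f ∘ y) c)

    exponent : Orient d → (Fin d → Fin d) → ℕ
    exponent O y = (suc d C 2) ∸ maj (ω O ∘ y)

    count-compatible : ∀ N O y → isAcyclicOrientation adj O ≡ true → isLinExt O y ≡ true →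
      countWithTotal d N (λ f → compatibleᵇ f O y) ≡ shiftedInvDen d (exponent O y) N
    count-compatible N O y acyclic linExt with listing-inverse (∧-elimˡ linExt)
    ... | y⁻¹ , y∘y⁻¹ , y⁻¹∘y =
      trans (countRisingAlong≡shiftedInvDen (flip _<ᵇ_) N (y ∘ opposite) (opposite ∘ y⁻¹) z∘z⁻¹ z⁻¹∘z
                                            (toℕ ∘ ω O ∘ y ∘ opposite))
            (cong (λ e → shiftedInvDen d e N) (sym (C2∸maj≡comaj-opposite (ω O ∘ y) ωy-injective)))
      where
      z∘z⁻¹ : ∀ v → y (opposite (opposite (y⁻¹ v))) ≡ v
      z∘z⁻¹ v = trans (cong y (opposite-involutive (y⁻¹ v))) (y∘y⁻¹ v)
      z⁻¹∘z : ∀ i → opposite (y⁻¹ (y (opposite i))) ≡ i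
      z⁻¹∘z i = trans (cong opposite (y⁻¹∘y (opposite i))) (opposite-involutive i)
      ωy-injective : ∀ i j → ω O (y i) ≡ ω O (y j) → i ≡ j
      ωy-injective i j e = listing-injective (∧-elimˡ linExt) i j (proj₁ (proj₁ (ω-natural O acyclic)) e)

    open Expansion adj adj-sym adj-irr ω ω-natural (Flip.isStrictTotalOrder <-isStrictTotalOrder)
                   compatibleᵇ compatibleᵇ⇒ ⇒compatibleᵇ exponent count-compatible public

  -- This is where 1 ≤ d matters: for d = 0 the empty tuple would count as a G-partition of 0.
  PG≡pG : {d : ℕ} (adj : Adj (suc d)) (n : ℕ) → PG adj n ≡ pG adj n
  PG≡pG adj zero = refl
  PG≡pG adj (suc n) = refl

open import Defs
open import Data.Bool using (true; false)
open import Data.Nat using (ℕ; suc; _≤_; s≤s; z≤n)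
open import Data.Fin using (Fin; _<_)
open import Data.Product using (_×_; _,_)
open import Function.Definitions using (Bijective)
open import Relation.Binary.PropositionalEquality using (_≡_; _≢_; trans)
open GPartitions using (PG≡pG; module FirstFormula; module SecondFormula)

theorem30 : (d : ℕ) → 1 ≤ d → (adj : Adj d)
    → (∀ u v → adj u v ≡ adj v u) → (∀ u → adj u u ≡ false)
    → (ω : Orient d → Fin d → Fin d)
    → (∀ O → isAcyclicOrientation adj O ≡ true →
         Bijective _≡_ _≡_ (ω O)
         × (∀ u w → u ≢ w → reach O u w ≡ true → ω O u < ω O w))
    → (∀ n → PG adj n ≡ (numer₁ adj ω ⊛ invDen d) n)
      × (∀ n → PG adj n ≡ (numer₂ adj ω ⊛ invDen d) n)
theorem30 (suc d) (s≤s z≤n) adj adj-sym adj-irr ω ω-natural =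
    (λ n → trans (PG≡pG adj n) (FirstFormula.pG≡numerator⊛invDen adj adj-sym adj-irr ω ω-natural n))
  , (λ n → trans (PG≡pG adj n) (SecondFormula.pG≡numerator⊛invDen adj adj-sym adj-irr ω ω-natural n))
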